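{- Let $a\ge1$, $b,c\ge0$ and $n=a+b+c$. Let $K(a1^bc)$ be the barbell graph with vertices $r_1,\dots,r_a,s_1,\dots,s_b,t_1,\dots,t_c$ in which $\{r_1,\dots,r_a\}$ is a clique, $r_as_1s_2\cdots s_b$ is a path, and $\{s_b,t_1,\dots,t_c\}$ is a clique, where $s_b$ is to be read as $r_a$ if $b=0$. Then \[ X_{K(a1^bc)}=(a-1)!\,c!\Biggl(\sum_{\substack{I\vDash n,\ i_{ -1}\ge a\\ i_1\ge c+1}}w_Ie_I+\sum_{\substack{I\vDash n,\ i_{ -1}\ge a\\ i_1\le c<i_2}}(i_2-i_1)\prod_{j\ge3}(i_j-1)\,e_I\Biggr). \]
   Context: A composition $I=i_1\cdots i_s\vDash n$ is a sequence of positive integers with sum $n$; $i_{ -1}=i_s$ is the last part; $e_I=e_{i_1}\cdots e_{i_s}$ (elementary symmetric functions); $w_I=i_1\prod_{j\ge2}(i_j-1)$. In the second sum, compositions have at least two parts. The chromatic symmetric function of a graph $G$ is $X_G=\sum_\kappa\prod_{v\in V(G)}x_{\kappa(v)}$ over proper colorings $\kappa:V(G)\to\{1,2,\dots\}$. -}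

module Defs where

open import Data.Bool using (Bool; true; false; if_then_else_; _∧_; _∨_; not)
open import Data.Nat using (ℕ; zero; suc; _+_; _*_; _∸_; _≡ᵇ_; _≤ᵇ_; _<ᵇ_; pred)
open import Data.Fin using (Fin; toℕ; _≟_)
open import Data.List.Base using (List; []; _∷_; [_]; map; concatMap; foldr; allFin; upTo)
open import Data.Product using (_×_; _,_)
open import Data.Vec.Functional using () renaming (_∷_ to _∷ᶠ_)
open import Data.Integer using (ℤ; +_) renaming (_+_ to _+ℤ_; _*_ to _*ℤ_)
open import Relation.Nullary using (does)

sumℤ : List ℤ → ℤ
sumℤ = foldr _+ℤ_ (+ 0)

prodℤ : List ℤ → ℤ
prodℤ = foldr _*ℤ_ (+ 1)

prodℕ : List ℕ → ℕ
prodℕ = foldr _*_ 1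

record Graph : Set where
  field
    size : ℕ
    adj  : Fin size → Fin size → Bool
open Graph public

allFuns : (m N : ℕ) → List (Fin m → Fin N)
allFuns zero    N = [ (λ ()) ]
allFuns (suc m) N = concatMap (λ i → map (λ f → i ∷ᶠ f) (allFuns m N)) (allFin N)

allPairs : (m : ℕ) → List (Fin m × Fin m)
allPairs m = concatMap (λ u → map (λ v → (u , v)) (allFin m)) (allFin m)

allᵇ : {A : Set} → (A → Bool) → List A → Bool
allᵇ p = foldr (λ a r → p a ∧ r) true

isProper : (G : Graph) {N : ℕ} → (Fin (size G) → Fin N) → Bool
isProper G κ = allᵇ (λ { (u , v) → not (adj G u v) ∨ not (does (κ u ≟ κ v)) }) (allPairs (size G))

-- Chromatic symmetric function X_G, specialised to the variables
-- x_1, …, x_N (all further variables set to 0), evaluated at x : Fin N → ℤ: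
--   X_G(x) = Σ_{κ proper, κ : V → {1..N}} Π_v x_{κ(v)}
chromSym : (G : Graph) (N : ℕ) → (Fin N → ℤ) → ℤ
chromSym G N x =
  sumℤ (map (λ κ → if isProper G κ then prodℤ (map (λ v → x (κ v)) (allFin (size G))) else + 0)
            (allFuns (size G) N))

-- Elementary symmetric polynomials e_k(x_1,…,x_N) (Pascal recursion:
-- subsets avoiding x_1 plus subsets containing x_1)

esym : (N : ℕ) → (Fin N → ℤ) → ℕ → ℤ
esym N       x zero    = + 1
esym zero    x (suc k) = + 0
esym (suc N) x (suc k) = x Fin.zero *ℤ esym N (λ i → x (Fin.suc i)) k +ℤ esym N (λ i → x (Fin.suc i)) (suc k)
  where import Data.Fin as Fin

eComp : (N : ℕ) → (Fin N → ℤ) → List ℕ → ℤ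
eComp N x I = prodℤ (map (esym N x) I)

-- Compositions of n: lists of positive integers with sum n.
-- compsF fuel n lists them by choice of first part k ∈ {1..n}.

compsF : ℕ → ℕ → List (List ℕ)
compsF _        zero    = [ [] ]
compsF zero     (suc _) = []
compsF (suc f)  (suc m) =
  concatMap (λ k → map (λ J → suc k ∷ J) (compsF f (m ∸ k))) (upTo (suc m))

compositions : ℕ → List (List ℕ)
compositions n = compsF n n

-- last part i_{-1} (only used on nonempty lists)
lastPart : List ℕ → ℕ
lastPart []           = 0
lastPart (i ∷ [])     = i
lastPart (_ ∷ j ∷ js) = lastPart (j ∷ js)

wComp : List ℕ → ℕ
wComp []       = 0
wComp (i ∷ is) = i * prodℕ (map pred is)

coef₁ : ℕ → ℕ → List ℕ → ℕ
coef₁ a c []         = 0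
coef₁ a c I@(i ∷ _)  = if (a ≤ᵇ lastPart I) ∧ (suc c ≤ᵇ i) then wComp I else 0

coef₂ : ℕ → ℕ → List ℕ → ℕ
coef₂ a c []                 = 0
coef₂ a c (_ ∷ [])           = 0
coef₂ a c I@(i₁ ∷ i₂ ∷ rest) =
  if (a ≤ᵇ lastPart I) ∧ (i₁ ≤ᵇ c) ∧ (c <ᵇ i₂) then (i₂ ∸ i₁) * prodℕ (map pred rest) else 0

-- Barbell graph K(a 1^b c) on Fin (a+b+c):
--   r_1..r_a ↦ 0..a−1,  s_1..s_b ↦ a..a+b−1,  t_1..t_c ↦ a+b..a+b+c−1.
-- Edges (u ≠ v): {r_i} clique (both < a); path r_a s_1 … s_b
-- (consecutive indices in [a−1, a+b−1]); clique {s_b, t_1..t_c}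
-- (both ≥ a+b−1; index a+b−1 is r_a when b = 0).

barbellAdjℕ : ℕ → ℕ → ℕ → ℕ → Bool
barbellAdjℕ a b u v =
  not (u ≡ᵇ v) ∧
  (  ((u <ᵇ a) ∧ (v <ᵇ a))
  ∨  (((suc u ≡ᵇ v) ∨ (suc v ≡ᵇ u))
        ∧ (a ∸ 1 ≤ᵇ u) ∧ (a ∸ 1 ≤ᵇ v) ∧ (u ≤ᵇ a + b ∸ 1) ∧ (v ≤ᵇ a + b ∸ 1))
  ∨  ((a + b ∸ 1 ≤ᵇ u) ∧ (a + b ∸ 1 ≤ᵇ v)))

barbell : ℕ → ℕ → ℕ → Graph
barbell a b c = record
  { size = a + b + c
  ; adj  = λ u v → barbellAdjℕ a b (toℕ u) (toℕ v) }

-- Colour the vertices in the order r₁, …, r_a, s₁, …, s_b, t₁, …, t_c, summing over the colour i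
-- of one vertex at a time; this forbids i on its later neighbours, i.e. sets xᵢ to 0 in their
-- weights. By Euler's identity Σᵢ xᵢ e_k(x|xᵢ=0) = (k+1) e_{k+1} the two cliques contribute (a−1)!
-- and c!, and X = (a−1)! c! H(a−1, b, c) with H(A, b, c) = Σⱼ xⱼ e_A(x|xⱼ=0) R_b(j) (reducedChrom),
-- where R_b(j) (tailWeight) accounts for the path and the second clique once r_a has colour j.
-- The Pascal rule e_{k+1} = xⱼ e_k(x|xⱼ=0) + e_{k+1}(x|xⱼ=0) gives the recursions
--   H(A, b+1, c) = A e_{A+1} H(0, b, c) + H(A+1, b, c),
--   H(A, 0, c+1) = H(A+1, 0, c) + (A − c) e_{A+1} e_{c+1},      H(A, 0, 0) = (A+1) e_{A+1}.
-- Splitting off the last part of a composition shows that the right-hand side obeys the same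
-- recursions: raising a by one removes exactly the compositions with last part a, and once the
-- parts before the last sum to at most c only the one- and two-part compositions contribute.

module Submission where

open import Defs

module _ where
  open import Data.Bool using (Bool; true; false; if_then_else_; _∧_; _∨_; not)
  open import Data.Bool.Properties using (∧-assoc; ∧-zeroʳ; ∧-identityʳ; T-≡; ¬-not)
  open import Data.Fin using (Fin; zero; suc; toℕ; _≟_)
  open import Data.Fin.Properties using (toℕ<n; toℕ-inject₁; toℕ-fromℕ)
  open import Data.Integer using (ℤ; +_; _+_; _*_; _-_)
  open import Data.Integer.Properties hiding (_≟_)
  open import Algebra.Properties.Semiring.Sum +-*-semiring
    using (sum-syntax; sum-cong-≗; sum-replicate-zero; sum-init-last; ∑-distrib-+; ∑-comm; *-distribˡ-sum)
  open import Data.Integer.Solver using (module +-*-Solver)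
  open import Data.List using (List; []; _∷_; [_]; _++_; map; concatMap; tabulate; allFin; applyUpTo; upTo)
  open import Data.List.Properties using (map-++; map-tabulate; map-cong; map-cong-local; map-∘; concatMap-cong)
  open import Data.List.Relation.Unary.All as All using (All; []; _∷_)
  open import Data.List.Relation.Unary.All.Properties using (concat⁺; map⁺; applyUpTo⁺₁)
  open import Data.Nat as ℕ using (ℕ; zero; suc; _∸_; _≤_; _<_; z≤n; s≤s; _≤ᵇ_; _<ᵇ_; _≡ᵇ_; z<s; _⊔_; pred; _!)
  open import Data.Nat.Induction using (<-rec)
  open import Data.Nat.ListAction using (sum)
  open import Data.Nat.Properties as ℕₚ using (m∸n≤m)
  open import Data.Product using (_×_; _,_; proj₁; proj₂)
  open import Data.Sum using (inj₁; inj₂)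
  open import Data.Vec.Functional using () renaming (_∷_ to _∷ᶠ_)
  open import Function.Bundles using (module Equivalence)
  open import Relation.Binary.Definitions using (Tri; tri<; tri≈; tri>)
  open import Relation.Binary.PropositionalEquality hiding ([_])
  open import Relation.Nullary using (does; yes; no; contradiction)
  open +-*-Solver

  <ᵇ-suc : ∀ m n → (m <ᵇ suc n) ≡ (m ≤ᵇ n)
  <ᵇ-suc zero    n       = refl
  <ᵇ-suc (suc m) zero    = refl
  <ᵇ-suc (suc m) (suc n) = refl

  ≤ᵇ-true : ∀ {m n} → m ≤ n → (m ≤ᵇ n) ≡ true
  ≤ᵇ-true m≤n = Equivalence.to T-≡ (ℕₚ.≤⇒≤ᵇ m≤n)

  ≤ᵇ-false : ∀ {m n} → n < m → (m ≤ᵇ n) ≡ false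
  ≤ᵇ-false {m} {n} n<m = ¬-not (λ m≤ᵇn → ℕₚ.<⇒≱ n<m (ℕₚ.≤ᵇ⇒≤ m n (Equivalence.from T-≡ m≤ᵇn)))

  ≤ᵇ-true⁻¹ : ∀ {m n} → (m ≤ᵇ n) ≡ true → m ≤ n
  ≤ᵇ-true⁻¹ {m} {n} m≤ᵇn = ℕₚ.≤ᵇ⇒≤ m n (Equivalence.from T-≡ m≤ᵇn)

  <ᵇ-false : ∀ {m n} → n ≤ m → (m <ᵇ n) ≡ false
  <ᵇ-false n≤m = ≤ᵇ-false (s≤s n≤m)

  pos-∸ : ∀ {m n} → n ≤ m → + (m ∸ n) ≡ + m - + n
  pos-∸ {m} {n} n≤m = trans (sym (⊖-≥ n≤m)) (sym (m-n≡m⊖n m n))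

  ≤ᵇ-∧-⊔ : ∀ m n k → (m ≤ᵇ k) ∧ (n ≤ᵇ k) ≡ (m ⊔ n ≤ᵇ k)
  ≤ᵇ-∧-⊔ zero    n       k       = refl
  ≤ᵇ-∧-⊔ (suc m) zero    k       = ∧-identityʳ (suc m ≤ᵇ k)
  ≤ᵇ-∧-⊔ (suc m) (suc n) zero    = refl
  ≤ᵇ-∧-⊔ (suc m) (suc n) (suc k) rewrite <ᵇ-suc m k | <ᵇ-suc n k | <ᵇ-suc (m ⊔ n) k = ≤ᵇ-∧-⊔ m n k

  ∑-distrib-sub : ∀ {n} (f g : Fin n → ℤ) → ∑[ i < n ] (f i - g i) ≡ ∑[ i < n ] f i - ∑[ i < n ] g i
  ∑-distrib-sub {zero}  f g = refl
  ∑-distrib-sub {suc n} f g =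
    trans (cong (_+_ (f zero - g zero)) (∑-distrib-sub (λ i → f (suc i)) (λ i → g (suc i))))
      (solve 4 (λ a b s t → (a :- b) :+ (s :- t) := (a :+ s) :- (b :+ t)) refl (f zero) (g zero) _ _)

  sumBelow : ℕ → (ℕ → ℤ) → ℤ
  sumBelow n f = ∑[ k < n ] f (toℕ k)

  sumBelow-cong : ∀ n {f g : ℕ → ℤ} → (∀ k → k < n → f k ≡ g k) → sumBelow n f ≡ sumBelow n g
  sumBelow-cong n f≡g = sum-cong-≗ (λ k → f≡g (toℕ k) (toℕ<n k))

  sumBelow-zero : ∀ n → sumBelow n (λ _ → + 0) ≡ + 0
  sumBelow-zero n = sum-replicate-zero n

  sumBelow-last : ∀ n (f : ℕ → ℤ) → sumBelow (suc n) f ≡ sumBelow n f + f n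
  sumBelow-last n f = trans (sum-init-last {n} (λ k → f (toℕ k)))
    (cong₂ _+_ (sum-cong-≗ {n} (λ k → cong f (toℕ-inject₁ k))) (cong f (toℕ-fromℕ n)))

  sumBelow-extend : ∀ {m n} (f : ℕ → ℤ) → m ≤ n → sumBelow m f ≡ sumBelow n (λ k → if k <ᵇ m then f k else + 0)
  sumBelow-extend {zero}  {n}     f _         = sym (sumBelow-zero n)
  sumBelow-extend {suc m} {suc n} f (s≤s m≤n) = cong (_+_ (f 0)) (sumBelow-extend (λ k → f (suc k)) m≤n)

  sumBelow-indicator : ∀ {n p} (f : ℕ → ℤ) → p < n → sumBelow n (λ k → if k ≡ᵇ p then f k else + 0) ≡ f p
  sumBelow-indicator {suc n} {zero}  f _         = trans (cong (_+_ (f 0)) (sumBelow-zero n)) (+-identityʳ (f 0))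
  sumBelow-indicator {suc n} {suc p} f (s≤s p<n) = trans (+-identityˡ _) (sumBelow-indicator (λ k → f (suc k)) p<n)

  if-≤ᵇ-split : ∀ m k (v : ℤ) → (if m ≤ᵇ k then v else + 0) ≡ (if suc m ≤ᵇ k then v else + 0) + (if k ≡ᵇ m then v else + 0)
  if-≤ᵇ-split zero    zero    v = sym (+-identityˡ v)
  if-≤ᵇ-split zero    (suc k) v = sym (+-identityʳ v)
  if-≤ᵇ-split (suc m) zero    v = refl
  if-≤ᵇ-split (suc m) (suc k) v = trans (cong (λ b → if b then v else + 0) (<ᵇ-suc m k)) (if-≤ᵇ-split m k v)

  sumBelow-threshold : ∀ {n m} (f : ℕ → ℤ) → m < n →
    sumBelow n (λ k → if m ≤ᵇ k then f k else + 0) ≡ sumBelow n (λ k → if suc m ≤ᵇ k then f k else + 0) + f m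
  sumBelow-threshold {n} {m} f m<n =
    trans (sumBelow-cong n (λ k _ → if-≤ᵇ-split m k (f k)))
      (trans (∑-distrib-+ {n} _ _) (cong (_+_ (sumBelow n (λ k → if suc m ≤ᵇ k then f k else + 0))) (sumBelow-indicator f m<n)))

  sumBelow-beyond : ∀ n (f : ℕ → ℤ) → sumBelow n (λ k → if n ≤ᵇ k then f k else + 0) ≡ + 0
  sumBelow-beyond n f =
    trans (sumBelow-cong n (λ k k<n → cong (λ b → if b then f k else + 0) (≤ᵇ-false k<n))) (sumBelow-zero n)

  sumBelow-∸ : ∀ n i (f : ℕ → ℤ) → sumBelow (n ∸ i) f ≡ sumBelow n (λ k → if i ℕ.+ k <ᵇ n then f k else + 0)
  sumBelow-∸ n i f = trans (sumBelow-extend f (m∸n≤m n i))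
    (sumBelow-cong n (λ k _ → cong (λ b → if b then f k else + 0) (<ᵇ-∸ i k n)))
    where
    <ᵇ-∸ : ∀ i k n → (k <ᵇ n ∸ i) ≡ (i ℕ.+ k <ᵇ n)
    <ᵇ-∸ zero    k n       = refl
    <ᵇ-∸ (suc i) k zero    = refl
    <ᵇ-∸ (suc i) k (suc n) = <ᵇ-∸ i k n

  sumBelow-triangle : ∀ n (F : ℕ → ℕ → ℤ) →
    sumBelow n (λ i → sumBelow (n ∸ i) (F i)) ≡ sumBelow n (λ k → sumBelow (n ∸ k) (λ i → F i k))
  sumBelow-triangle n F = begin
      sumBelow n (λ i → sumBelow (n ∸ i) (F i))
    ≡⟨ sumBelow-cong n (λ i _ → sumBelow-∸ n i (F i)) ⟩
      sumBelow n (λ i → sumBelow n (λ k → if i ℕ.+ k <ᵇ n then F i k else + 0))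
    ≡⟨ ∑-comm {n} {n} _ ⟩
      sumBelow n (λ k → sumBelow n (λ i → if i ℕ.+ k <ᵇ n then F i k else + 0))
    ≡⟨ sumBelow-cong n (λ k _ → sumBelow-cong n (λ i _ → cong (λ m → if m <ᵇ n then F i k else + 0) (ℕₚ.+-comm i k))) ⟩
      sumBelow n (λ k → sumBelow n (λ i → if k ℕ.+ i <ᵇ n then F i k else + 0))
    ≡⟨ sumBelow-cong n (λ k _ → sumBelow-∸ n k (λ i → F i k)) ⟨
      sumBelow n (λ k → sumBelow (n ∸ k) (λ i → F i k))
    ∎
    where open ≡-Reasoning

  sumℤ-++ : (xs ys : List ℤ) → sumℤ (xs ++ ys) ≡ sumℤ xs + sumℤ ys
  sumℤ-++ []       ys = sym (+-identityˡ _)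
  sumℤ-++ (x ∷ xs) ys = trans (cong (_+_ x) (sumℤ-++ xs ys)) (sym (+-assoc x _ _))

  sumℤ-concatMap : ∀ {A B : Set} (g : B → ℤ) (f : A → List B) (xs : List A) →
    sumℤ (map g (concatMap f xs)) ≡ sumℤ (map (λ a → sumℤ (map g (f a))) xs)
  sumℤ-concatMap g f []       = refl
  sumℤ-concatMap g f (x ∷ xs) =
    trans (cong sumℤ (map-++ g (f x) (concatMap f xs)))
      (trans (sumℤ-++ (map g (f x)) _) (cong (_+_ (sumℤ (map g (f x)))) (sumℤ-concatMap g f xs)))

  sumℤ-map-+ : ∀ {A : Set} (f g : A → ℤ) (xs : List A) →
    sumℤ (map (λ a → f a + g a) xs) ≡ sumℤ (map f xs) + sumℤ (map g xs)
  sumℤ-map-+ f g []       = refl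
  sumℤ-map-+ f g (x ∷ xs) = trans (cong (_+_ (f x + g x)) (sumℤ-map-+ f g xs))
    (solve 4 (λ a b c d → (a :+ b) :+ (c :+ d) := (a :+ c) :+ (b :+ d)) refl (f x) (g x) _ _)

  sumℤ-map-*ˡ : ∀ {A : Set} (c : ℤ) (g : A → ℤ) (xs : List A) → sumℤ (map (λ a → c * g a) xs) ≡ c * sumℤ (map g xs)
  sumℤ-map-*ˡ c g []       = sym (*-zeroʳ c)
  sumℤ-map-*ˡ c g (x ∷ xs) = trans (cong (_+_ (c * g x)) (sumℤ-map-*ˡ c g xs)) (sym (*-distribˡ-+ c (g x) _))

  sumℤ-map-zero : ∀ {A : Set} (xs : List A) → sumℤ (map (λ _ → + 0) xs) ≡ + 0
  sumℤ-map-zero []       = refl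
  sumℤ-map-zero (x ∷ xs) = trans (+-identityˡ _) (sumℤ-map-zero xs)

  sumℤ-tabulate : ∀ {A : Set} m (g : A → ℤ) (f : Fin m → A) → sumℤ (map g (tabulate f)) ≡ ∑[ i < m ] g (f i)
  sumℤ-tabulate zero    g f = refl
  sumℤ-tabulate (suc m) g f = cong (_+_ (g (f zero))) (sumℤ-tabulate m g (λ i → f (suc i)))

  sumℤ-map-upTo : ∀ n (h : ℕ → ℤ) → sumℤ (map h (upTo n)) ≡ sumBelow n h
  sumℤ-map-upTo n h = go n h (λ k → k)
    where
    go : ∀ n (h : ℕ → ℤ) (f : ℕ → ℕ) → sumℤ (map h (applyUpTo f n)) ≡ sumBelow n (λ k → h (f k))
    go zero    h f = refl
    go (suc n) h f = cong (_+_ (h (f 0))) (go n h (λ k → f (suc k)))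

  zeroAt : ∀ {N} → (Fin N → ℤ) → Fin N → Fin N → ℤ
  zeroAt z i j = if does (j ≟ i) then + 0 else z j

  does-≟-sym : ∀ {N} (i j : Fin N) → does (i ≟ j) ≡ does (j ≟ i)
  does-≟-sym i j with i ≟ j | j ≟ i
  ... | yes _   | yes _   = refl
  ... | no  _   | no  _   = refl
  ... | yes i≡j | no  j≢i = contradiction (sym i≡j) j≢i
  ... | no  i≢j | yes j≡i = contradiction (sym j≡i) i≢j

  zeroAt-comm : ∀ {N} (z : Fin N → ℤ) i j k → zeroAt (zeroAt z i) j k ≡ zeroAt (zeroAt z j) i k
  zeroAt-comm z i j k with does (k ≟ i) | does (k ≟ j)
  ... | false | false = refl
  ... | false | true  = refl
  ... | true  | false = refl
  ... | true  | true  = refl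

  *-zeroAt-sym : ∀ {N} (z : Fin N → ℤ) i j → z i * zeroAt z i j ≡ z j * zeroAt z j i
  *-zeroAt-sym z i j with does (j ≟ i) | does (i ≟ j) | does-≟-sym j i
  ... | false | .false | refl = *-comm (z i) (z j)
  ... | true  | .true  | refl = trans (*-zeroʳ (z i)) (sym (*-zeroʳ (z j)))

  sum-zeroAt : ∀ {N} (z f : Fin N → ℤ) (i : Fin N) →
    ∑[ j < N ] (zeroAt z i j * f j) ≡ ∑[ j < N ] (z j * f j) - z i * f i
  sum-zeroAt {suc N} z f zero =
    solve 2 (λ a s → con (+ 0) :* a :+ s := a :+ s :- a) refl (z zero * f zero) (∑[ j < N ] (z (suc j) * f (suc j)))
  sum-zeroAt {suc N} z f (suc i) =
    trans (cong (_+_ (z zero * f zero)) (sum-zeroAt (λ j → z (suc j)) (λ j → f (suc j)) i))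
      (solve 3 (λ a s b → a :+ (s :- b) := a :+ s :- b) refl (z zero * f zero) (∑[ j < N ] (z (suc j) * f (suc j))) (z (suc i) * f (suc i)))

  esym-cong : ∀ N {z z′ : Fin N → ℤ} → (∀ j → z j ≡ z′ j) → ∀ k → esym N z k ≡ esym N z′ k
  esym-cong N       z≡z′ zero    = refl
  esym-cong zero    z≡z′ (suc k) = refl
  esym-cong (suc N) z≡z′ (suc k) =
    cong₂ _+_ (cong₂ _*_ (z≡z′ zero) (esym-cong N (λ j → z≡z′ (suc j)) k)) (esym-cong N (λ j → z≡z′ (suc j)) (suc k))

  esym-zeroAt-zero : ∀ N (z : Fin (suc N) → ℤ) k → esym (suc N) (zeroAt z zero) k ≡ esym N (λ j → z (suc j)) k
  esym-zeroAt-zero N z zero    = refl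
  esym-zeroAt-zero N z (suc k) =
    trans (cong (_+ esym N (λ j → z (suc j)) (suc k)) (*-zeroˡ (esym N (λ j → z (suc j)) k))) (+-identityˡ _)

  esym-pascal : ∀ N (z : Fin N → ℤ) (i : Fin N) k → esym N z (suc k) ≡ z i * esym N (zeroAt z i) k + esym N (zeroAt z i) (suc k)
  esym-pascal (suc N) z zero k = sym (cong₂ _+_ (cong (z zero *_) (esym-zeroAt-zero N z k)) (esym-zeroAt-zero N z (suc k)))
  esym-pascal (suc N) z (suc i) zero =
    trans (cong (_+_ (z zero * + 1)) (esym-pascal N z′ i zero))
      (solve 3 (λ a c d → a :* con (+ 1) :+ (c :* con (+ 1) :+ d) := c :* con (+ 1) :+ (a :* con (+ 1) :+ d)) refl
        (z zero) (z (suc i)) (esym N (zeroAt z′ i) 1))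
    where
    z′ : Fin N → ℤ
    z′ j = z (suc j)
  esym-pascal (suc N) z (suc i) (suc k) =
    trans (cong₂ (λ t u → z zero * t + u) (esym-pascal N z′ i k) (esym-pascal N z′ i (suc k)))
      (solve 5 (λ z₀ zᵢ a b c → z₀ :* (zᵢ :* a :+ b) :+ (zᵢ :* b :+ c) := zᵢ :* (z₀ :* a :+ b) :+ (z₀ :* b :+ c)) refl
        (z zero) (z (suc i)) (e k) (e (suc k)) (e (suc (suc k))))
    where
    z′ : Fin N → ℤ
    z′ j = z (suc j)
    e : ℕ → ℤ
    e = esym N (zeroAt z′ i)

  esym-zeroAt-symmetric : ∀ {N} (z : Fin N → ℤ) k i j →
    z i * zeroAt z i j * esym N (zeroAt (zeroAt z i) j) k ≡ z j * zeroAt z j i * esym N (zeroAt (zeroAt z j) i) k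
  esym-zeroAt-symmetric {N} z k i j =
    cong₂ _*_ (*-zeroAt-sym z i j) (esym-cong N (zeroAt-comm z i j) k)

  -- e_k(z|zᵢ=0) = ∂e_{k+1}/∂zᵢ, so this is Euler's identity for the homogeneous polynomial e_{k+1}.
  esym-euler : ∀ N (z : Fin N → ℤ) k → ∑[ i < N ] (z i * esym N (zeroAt z i) k) ≡ + suc k * esym N z (suc k)
  esym-euler zero    z k = sym (*-zeroʳ (+ suc k))
  esym-euler (suc N) z zero =
    trans (cong (_+_ (z zero * + 1)) (esym-euler N (λ j → z (suc j)) zero))
      (solve 2 (λ a e → a :* con (+ 1) :+ con (+ 1) :* e := con (+ 1) :* (a :* con (+ 1) :+ e)) refl
        (z zero) (esym N (λ j → z (suc j)) 1))
  esym-euler (suc N) z (suc k) = begin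
      z zero * esym (suc N) (zeroAt z zero) (suc k) + ∑[ i < N ] (z′ i * (z zero * e′ i k + e′ i (suc k)))
    ≡⟨ cong₂ _+_ (cong (z zero *_) (esym-zeroAt-zero N z (suc k))) distribute ⟩
      z zero * e (suc k) + (z zero * ∑[ i < N ] (z′ i * e′ i k) + ∑[ i < N ] (z′ i * e′ i (suc k)))
    ≡⟨ cong₂ (λ s t → z zero * e (suc k) + (z zero * s + t)) (esym-euler N z′ k) (esym-euler N z′ (suc k)) ⟩
      z zero * e (suc k) + (z zero * (+ suc k * e (suc k)) + + suc (suc k) * e (suc (suc k)))
    ≡⟨ solve 4 (λ a f K g → a :* f :+ (a :* (K :* f) :+ (con (+ 1) :+ K) :* g) := (con (+ 1) :+ K) :* (a :* f :+ g)) refl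
         (z zero) (e (suc k)) (+ suc k) (e (suc (suc k))) ⟩
      + suc (suc k) * (z zero * e (suc k) + e (suc (suc k)))
    ∎
    where
    open ≡-Reasoning
    z′ : Fin N → ℤ
    z′ j = z (suc j)
    e : ℕ → ℤ
    e = esym N z′
    e′ : Fin N → ℕ → ℤ
    e′ i = esym N (zeroAt z′ i)
    distribute : ∑[ i < N ] (z′ i * (z zero * e′ i k + e′ i (suc k)))
               ≡ z zero * ∑[ i < N ] (z′ i * e′ i k) + ∑[ i < N ] (z′ i * e′ i (suc k))
    distribute =
      trans (sum-cong-≗ {N} (λ i → solve 4 (λ a b c d → a :* (b :* c :+ d) := b :* (a :* c) :+ a :* d) refl
                                     (z′ i) (z zero) (e′ i k) (e′ i (suc k))))
        (trans (∑-distrib-+ {N} _ _)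
          (cong (_+ ∑[ i < N ] (z′ i * e′ i (suc k))) (sym (*-distribˡ-sum (z zero) (λ i → z′ i * e′ i k)))))

  esym-euler-nested : ∀ N (z T : Fin N → ℤ) k →
    ∑[ i < N ] (z i * ∑[ j < N ] (zeroAt z i j * esym N (zeroAt (zeroAt z i) j) k * T j))
      ≡ + suc k * ∑[ j < N ] (z j * esym N (zeroAt z j) (suc k) * T j)
  esym-euler-nested N z T k = begin
      ∑[ i < N ] (z i * ∑[ j < N ] (zeroAt z i j * e₂ i j * T j))
    ≡⟨ sum-cong-≗ {N} (λ i → *-distribˡ-sum (z i) (λ j → zeroAt z i j * e₂ i j * T j)) ⟩
      ∑[ i < N ] ∑[ j < N ] (z i * (zeroAt z i j * e₂ i j * T j))
    ≡⟨ ∑-comm {N} {N} (λ i j → z i * (zeroAt z i j * e₂ i j * T j)) ⟩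
      ∑[ j < N ] ∑[ i < N ] (z i * (zeroAt z i j * e₂ i j * T j))
    ≡⟨ sum-cong-≗ {N} (λ j → trans (sum-cong-≗ {N} (λ i → swap i j))
                                 (sym (*-distribˡ-sum (z j * T j) (λ i → zeroAt z j i * e₂ j i)))) ⟩
      ∑[ j < N ] (z j * T j * ∑[ i < N ] (zeroAt z j i * e₂ j i))
    ≡⟨ sum-cong-≗ {N} (λ j → trans (cong (z j * T j *_) (esym-euler N (zeroAt z j) k))
         (solve 4 (λ p r s f → p :* r :* (s :* f) := s :* (p :* f :* r)) refl (z j) (T j) (+ suc k) (esym N (zeroAt z j) (suc k)))) ⟩
      ∑[ j < N ] (+ suc k * (z j * esym N (zeroAt z j) (suc k) * T j))
    ≡⟨ *-distribˡ-sum (+ suc k) (λ j → z j * esym N (zeroAt z j) (suc k) * T j) ⟨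
      + suc k * ∑[ j < N ] (z j * esym N (zeroAt z j) (suc k) * T j)
    ∎
    where
    open ≡-Reasoning
    e₂ : Fin N → Fin N → ℤ
    e₂ i j = esym N (zeroAt (zeroAt z i) j) k
    swap : ∀ i j → z i * (zeroAt z i j * e₂ i j * T j) ≡ z j * T j * (zeroAt z j i * e₂ j i)
    swap i j = begin
        z i * (zeroAt z i j * e₂ i j * T j)
      ≡⟨ solve 4 (λ p q f r → p :* (q :* f :* r) := p :* q :* f :* r) refl (z i) (zeroAt z i j) (e₂ i j) (T j) ⟩
        z i * zeroAt z i j * e₂ i j * T j
      ≡⟨ cong (_* T j) (esym-zeroAt-symmetric z k i j) ⟩
        z j * zeroAt z j i * e₂ j i * T j
      ≡⟨ solve 4 (λ p q f r → p :* q :* f :* r := p :* r :* (q :* f)) refl (z j) (zeroAt z j i) (e₂ j i) (T j) ⟩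
        z j * T j * (zeroAt z j i * e₂ j i)
      ∎

  andFin : (m : ℕ) → (Fin m → Bool) → Bool
  andFin zero    p = true
  andFin (suc m) p = p zero ∧ andFin m (λ i → p (suc i))

  prodFin : (m : ℕ) → (Fin m → ℤ) → ℤ
  prodFin zero    g = + 1
  prodFin (suc m) g = g zero * prodFin m (λ i → g (suc i))

  andFin-cong : ∀ m {p q : Fin m → Bool} → (∀ i → p i ≡ q i) → andFin m p ≡ andFin m q
  andFin-cong zero    p≡q = refl
  andFin-cong (suc m) p≡q = cong₂ _∧_ (p≡q zero) (andFin-cong m (λ i → p≡q (suc i)))

  prodFin-cong : ∀ m {g h : Fin m → ℤ} → (∀ i → g i ≡ h i) → prodFin m g ≡ prodFin m h
  prodFin-cong zero    g≡h = refl
  prodFin-cong (suc m) g≡h = cong₂ _*_ (g≡h zero) (prodFin-cong m (λ i → g≡h (suc i)))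

  andFin-∧ : ∀ m (p q : Fin m → Bool) → andFin m (λ i → p i ∧ q i) ≡ andFin m p ∧ andFin m q
  andFin-∧ zero    p q = refl
  andFin-∧ (suc m) p q with p zero | q zero
  ... | false | _     = refl
  ... | true  | false = sym (∧-zeroʳ (andFin m (λ i → p (suc i))))
  ... | true  | true  = andFin-∧ m (λ i → p (suc i)) (λ i → q (suc i))

  prodFin-if : ∀ m (ok : Fin m → Bool) (g : Fin m → ℤ) →
    prodFin m (λ v → if ok v then g v else + 0) ≡ (if andFin m ok then prodFin m g else + 0)
  prodFin-if zero    ok g = refl
  prodFin-if (suc m) ok g with ok zero
  ... | false = *-zeroˡ (prodFin m (λ v → if ok (suc v) then g (suc v) else + 0))
  ... | true  = trans (cong (g zero *_) (prodFin-if m (λ v → ok (suc v)) (λ v → g (suc v))))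
                      (*-if (andFin m (λ v → ok (suc v))))
    where
    *-if : ∀ b → g zero * (if b then prodFin m (λ v → g (suc v)) else + 0)
               ≡ (if b then g zero * prodFin m (λ v → g (suc v)) else + 0)
    *-if false = *-zeroʳ (g zero)
    *-if true  = refl

  if-∧-*ˡ : ∀ (c₁ c₂ p : Bool) (a g : ℤ) →
    (if c₁ ∧ (c₂ ∧ p) then a * g else + 0) ≡ a * (if p then (if c₁ ∧ c₂ then g else + 0) else + 0)
  if-∧-*ˡ false c₂    false a g = sym (*-zeroʳ a)
  if-∧-*ˡ false c₂    true  a g = sym (*-zeroʳ a)
  if-∧-*ˡ true  false false a g = sym (*-zeroʳ a)
  if-∧-*ˡ true  false true  a g = sym (*-zeroʳ a)
  if-∧-*ˡ true  true  false a g = sym (*-zeroʳ a)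
  if-∧-*ˡ true  true  true  a g = refl

  if-∨-∧ : ∀ (a b d : Bool) {t : ℤ} → (if (a ∨ b) ∧ d then + 0 else t) ≡ (if (not a ∨ not d) ∧ (not b ∨ not d) then t else + 0)
  if-∨-∧ false false d    = refl
  if-∨-∧ false true  false = refl
  if-∨-∧ false true  true  = refl
  if-∨-∧ true  false false = refl
  if-∨-∧ true  true  false = refl
  if-∨-∧ true  false true  = refl
  if-∨-∧ true  true  true  = refl

  allᵇ-++ : ∀ {A : Set} (p : A → Bool) xs ys → allᵇ p (xs ++ ys) ≡ allᵇ p xs ∧ allᵇ p ys
  allᵇ-++ p []       ys = refl
  allᵇ-++ p (x ∷ xs) ys = trans (cong (p x ∧_) (allᵇ-++ p xs ys)) (sym (∧-assoc (p x) _ _))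

  allᵇ-concatMap : ∀ {A B : Set} (p : B → Bool) (f : A → List B) xs →
    allᵇ p (concatMap f xs) ≡ allᵇ (λ a → allᵇ p (f a)) xs
  allᵇ-concatMap p f []       = refl
  allᵇ-concatMap p f (x ∷ xs) = trans (allᵇ-++ p (f x) (concatMap f xs)) (cong (allᵇ p (f x) ∧_) (allᵇ-concatMap p f xs))

  allᵇ-tabulate : ∀ {A : Set} m (p : A → Bool) (f : Fin m → A) → allᵇ p (tabulate f) ≡ andFin m (λ i → p (f i))
  allᵇ-tabulate zero    p f = refl
  allᵇ-tabulate (suc m) p f = cong (p (f zero) ∧_) (allᵇ-tabulate m p (λ i → f (suc i)))

  allᵇ-allPairs : ∀ m (P : Fin m → Fin m → Bool) →
    allᵇ (λ uv → P (proj₁ uv) (proj₂ uv)) (allPairs m) ≡ andFin m (λ u → andFin m (λ v → P u v))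
  allᵇ-allPairs m P =
    trans (allᵇ-concatMap _ _ (allFin m))
      (trans (allᵇ-tabulate m _ (λ u → u))
        (andFin-cong m (λ u → trans (cong (allᵇ P′) (map-tabulate {n = m} (λ v → v) (u ,_))) (allᵇ-tabulate m P′ (u ,_)))))
    where
    P′ : Fin m × Fin m → Bool
    P′ uv = P (proj₁ uv) (proj₂ uv)

  prodℤ-map-tabulate : ∀ {A : Set} m (g : A → ℤ) (f : Fin m → A) → prodℤ (map g (tabulate f)) ≡ prodFin m (λ i → g (f i))
  prodℤ-map-tabulate zero    g f = refl
  prodℤ-map-tabulate (suc m) g f = cong (g (f zero) *_) (prodℤ-map-tabulate m g (λ i → f (suc i)))

  adjGraph : ℕ → (ℕ → ℕ → Bool) → Graph
  adjGraph m E = record { size = m ; adj = λ u v → E (toℕ u) (toℕ v) }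

  -- Vertices are indexed by ℕ so that deleting vertex 0 is the shift E (suc u) (suc v); the weights
  -- y v depend on the vertex so that a colour used on vertex 0 can be removed from its neighbours.
  weightedChrom : (m N : ℕ) → (ℕ → ℕ → Bool) → (ℕ → Fin N → ℤ) → ℤ
  weightedChrom m N E y =
    sumℤ (map (λ κ → if isProper (adjGraph m E) κ then prodℤ (map (λ v → y (toℕ v) (κ v)) (allFin m)) else + 0)
              (allFuns m N))

  properAt : ∀ m {N} (E : ℕ → ℕ → Bool) (κ : Fin m → Fin N) → Fin m → Fin m → Bool
  properAt m E κ u v = not (E (toℕ u) (toℕ v)) ∨ not (does (κ u ≟ κ v))

  colouringWeight : ∀ m N (E : ℕ → ℕ → Bool) (y : ℕ → Fin N → ℤ) → (Fin m → Fin N) → ℤ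
  colouringWeight m N E y κ =
    if andFin m (λ u → andFin m (properAt m E κ u)) then prodFin m (λ v → y (toℕ v) (κ v)) else + 0

  weightedChrom-unfold : ∀ m N E y → weightedChrom m N E y ≡ sumℤ (map (colouringWeight m N E y) (allFuns m N))
  weightedChrom-unfold m N E y = cong sumℤ (map-cong (λ κ →
    cong₂ (λ b t → if b then t else + 0) (allᵇ-allPairs m (properAt m E κ)) (prodℤ-map-tabulate m _ (λ v → v)))
    (allFuns m N))

  weightedChrom-cong : ∀ m N E E′ y y′ →
    (∀ (u v : Fin m) → E (toℕ u) (toℕ v) ≡ E′ (toℕ u) (toℕ v)) → (∀ (v : Fin m) j → y (toℕ v) j ≡ y′ (toℕ v) j) →
    weightedChrom m N E y ≡ weightedChrom m N E′ y′
  weightedChrom-cong m N E E′ y y′ E≡E′ y≡y′ =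
    trans (weightedChrom-unfold m N E y)
      (trans (cong sumℤ (map-cong (λ κ → cong₂ (λ b t → if b then t else + 0)
                  (andFin-cong m (λ u → andFin-cong m (λ v → cong (λ t → not t ∨ _) (E≡E′ u v))))
                  (prodFin-cong m (λ v → y≡y′ v (κ v)))) (allFuns m N)))
        (sym (weightedChrom-unfold m N E′ y′)))

  peelWeights : ∀ {N} (E : ℕ → ℕ → Bool) (y : ℕ → Fin N → ℤ) (i : Fin N) → ℕ → Fin N → ℤ
  peelWeights E y i v j = if (E 0 (suc v) ∨ E (suc v) 0) ∧ does (j ≟ i) then + 0 else y (suc v) j

  colouringWeight-∷ : ∀ m N E y → E 0 0 ≡ false → ∀ i (f : Fin m → Fin N) →
    colouringWeight (suc m) N E y (i ∷ᶠ f) ≡ y 0 i * colouringWeight m N (λ u v → E (suc u) (suc v)) (peelWeights E y i) f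
  colouringWeight-∷ m N E y E00≡false i f = begin
      (if (properAt (suc m) E κ zero zero ∧ andFin m from0) ∧ andFin m (λ u → to0 u ∧ andFin m (properAt m E′ f u))
       then y 0 i * G else + 0)
    ≡⟨ cong (λ b → if ((not b ∨ not (does (i ≟ i))) ∧ andFin m from0) ∧ andFin m (λ u → to0 u ∧ andFin m (properAt m E′ f u))
                   then y 0 i * G else + 0) E00≡false ⟩
      (if andFin m from0 ∧ andFin m (λ u → to0 u ∧ andFin m (properAt m E′ f u)) then y 0 i * G else + 0)
    ≡⟨ cong (λ b → if andFin m from0 ∧ b then y 0 i * G else + 0) (andFin-∧ m to0 _) ⟩
      (if andFin m from0 ∧ (andFin m to0 ∧ proper′) then y 0 i * G else + 0)
    ≡⟨ if-∧-*ˡ (andFin m from0) (andFin m to0) proper′ (y 0 i) G ⟩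
      y 0 i * (if proper′ then (if andFin m from0 ∧ andFin m to0 then G else + 0) else + 0)
    ≡⟨ cong (λ t → y 0 i * (if proper′ then t else + 0)) peeledProduct ⟨
      y 0 i * (if proper′ then prodFin m (λ v → peelWeights E y i (toℕ v) (f v)) else + 0)
    ∎
    where
    open ≡-Reasoning
    κ : Fin (suc m) → Fin N
    κ = i ∷ᶠ f
    E′ : ℕ → ℕ → Bool
    E′ u v = E (suc u) (suc v)
    from0 to0 : Fin m → Bool
    from0 v = properAt (suc m) E κ zero (suc v)
    to0 v = properAt (suc m) E κ (suc v) zero
    proper′ : Bool
    proper′ = andFin m (λ u → andFin m (properAt m E′ f u))
    G : ℤ
    G = prodFin m (λ v → y (suc (toℕ v)) (f v))
    peelWeight≡ : ∀ v → peelWeights E y i (toℕ v) (f v) ≡ (if from0 v ∧ to0 v then y (suc (toℕ v)) (f v) else + 0)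
    peelWeight≡ v rewrite does-≟-sym (f v) i = if-∨-∧ (E 0 (suc (toℕ v))) (E (suc (toℕ v)) 0) (does (i ≟ f v))
    peeledProduct : prodFin m (λ v → peelWeights E y i (toℕ v) (f v)) ≡ (if andFin m from0 ∧ andFin m to0 then G else + 0)
    peeledProduct = trans (prodFin-cong m peelWeight≡)
      (trans (prodFin-if m (λ v → from0 v ∧ to0 v) _) (cong (λ b → if b then G else + 0) (andFin-∧ m from0 to0)))

  weightedChrom-peel : ∀ m N E y → E 0 0 ≡ false →
    weightedChrom (suc m) N E y
      ≡ ∑[ i < N ] (y 0 i * weightedChrom m N (λ u v → E (suc u) (suc v)) (peelWeights E y i))
  weightedChrom-peel m N E y E00≡false = begin
      weightedChrom (suc m) N E y
    ≡⟨ weightedChrom-unfold (suc m) N E y ⟩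
      sumℤ (map (colouringWeight (suc m) N E y) (concatMap (λ i → map (i ∷ᶠ_) (allFuns m N)) (allFin N)))
    ≡⟨ trans (sumℤ-concatMap _ _ (allFin N)) (sumℤ-tabulate N _ (λ i → i)) ⟩
      ∑[ i < N ] sumℤ (map (colouringWeight (suc m) N E y) (map (i ∷ᶠ_) (allFuns m N)))
    ≡⟨ sum-cong-≗ {N} (λ i → cong sumℤ (trans (sym (map-∘ (allFuns m N)))
                         (map-cong (colouringWeight-∷ m N E y E00≡false i) (allFuns m N)))) ⟩
      ∑[ i < N ] sumℤ (map (λ f → y 0 i * colouringWeight m N E′ (peelWeights E y i) f) (allFuns m N))
    ≡⟨ sum-cong-≗ {N} (λ i → trans (sumℤ-map-*ˡ (y 0 i) _ (allFuns m N))
                         (cong (y 0 i *_) (sym (weightedChrom-unfold m N E′ (peelWeights E y i))))) ⟩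
      ∑[ i < N ] (y 0 i * weightedChrom m N E′ (peelWeights E y i))
    ∎
    where
    open ≡-Reasoning
    E′ : ℕ → ℕ → Bool
    E′ u v = E (suc u) (suc v)

  weightedChrom-complete : ∀ m N (z : Fin N → ℤ) → weightedChrom m N (λ u v → not (u ≡ᵇ v)) (λ _ → z) ≡ + (m !) * esym N z m
  weightedChrom-complete zero    N z = refl
  weightedChrom-complete (suc m) N z = begin
      weightedChrom (suc m) N (λ u v → not (u ≡ᵇ v)) (λ _ → z)
    ≡⟨ weightedChrom-peel m N (λ u v → not (u ≡ᵇ v)) (λ _ → z) refl ⟩
      ∑[ i < N ] (z i * weightedChrom m N (λ u v → not (u ≡ᵇ v)) (λ _ → zeroAt z i))
    ≡⟨ sum-cong-≗ {N} (λ i → trans (cong (z i *_) (weightedChrom-complete m N (zeroAt z i)))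
                                (solve 3 (λ a b c → a :* (b :* c) := b :* (a :* c)) refl (z i) (+ (m !)) (esym N (zeroAt z i) m))) ⟩
      ∑[ i < N ] (+ (m !) * (z i * esym N (zeroAt z i) m))
    ≡⟨ trans (sym (*-distribˡ-sum (+ (m !)) (λ i → z i * esym N (zeroAt z i) m))) (cong (+ (m !) *_) (esym-euler N z m)) ⟩
      + (m !) * (+ suc m * esym N z (suc m))
    ≡⟨ trans (sym (*-assoc (+ (m !)) (+ suc m) _)) (cong (_* esym N z (suc m)) (trans (*-comm (+ (m !)) (+ suc m)) (sym (pos-* (suc m) (m !))))) ⟩
      + (suc m !) * esym N z (suc m)
    ∎
    where open ≡-Reasoning

  barbellAdj-shift-clique : ∀ a b u v → barbellAdjℕ (suc (suc a)) b (suc u) (suc v) ≡ barbellAdjℕ (suc a) b u v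
  barbellAdj-shift-clique a b u v
    rewrite <ᵇ-suc a u | <ᵇ-suc a v | <ᵇ-suc u (a ℕ.+ b) | <ᵇ-suc v (a ℕ.+ b) | <ᵇ-suc (a ℕ.+ b) u | <ᵇ-suc (a ℕ.+ b) v
    = refl

  barbellAdj-shift-path : ∀ b u v → barbellAdjℕ 1 (suc b) (suc u) (suc v) ≡ barbellAdjℕ 1 b u v
  barbellAdj-shift-path b u v rewrite <ᵇ-suc u b | <ᵇ-suc v b | <ᵇ-suc b u | <ᵇ-suc b v = noClique u v _
    where
    noClique : ∀ u v (t : Bool) → not (u ≡ᵇ v) ∧ t ≡ not (u ≡ᵇ v) ∧ (((u <ᵇ 1) ∧ (v <ᵇ 1)) ∨ t)
    noClique zero    zero    t = refl
    noClique zero    (suc v) t = refl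
    noClique (suc u) v       t = refl

  barbellAdj-shift-complete : ∀ u v → barbellAdjℕ 1 0 (suc u) (suc v) ≡ not (u ≡ᵇ v)
  barbellAdj-shift-complete u v =
    trans (cong (not (u ≡ᵇ v) ∧_) (∧-false-∨-true ((suc u ≡ᵇ v) ∨ (suc v ≡ᵇ u)))) (∧-identityʳ _)
    where
    ∧-false-∨-true : ∀ t → (t ∧ false) ∨ true ≡ true
    ∧-false-∨-true false = refl
    ∧-false-∨-true true  = refl

  barbellAdj-nbr₀-clique : ∀ a b v → (barbellAdjℕ (suc (suc a)) b 0 (suc v) ∨ barbellAdjℕ (suc (suc a)) b (suc v) 0) ≡ (v <ᵇ suc a)
  barbellAdj-nbr₀-clique a b zero    = refl
  barbellAdj-nbr₀-clique a b (suc w) with w <ᵇ a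
  ... | true  = refl
  ... | false = ∧-zeroʳ (a ℕ.+ b <ᵇ suc (suc w))

  barbellAdj-nbr₀-path : ∀ b v → (barbellAdjℕ 1 (suc b) 0 (suc v) ∨ barbellAdjℕ 1 (suc b) (suc v) 0) ≡ (v <ᵇ 1)
  barbellAdj-nbr₀-path b zero    = refl
  barbellAdj-nbr₀-path b (suc w) = ∧-zeroʳ (b <ᵇ suc (suc w))

  barbellAdj-nbr₀-complete : ∀ v → (barbellAdjℕ 1 0 0 (suc v) ∨ barbellAdjℕ 1 0 (suc v) 0) ≡ true
  barbellAdj-nbr₀-complete zero    = refl
  barbellAdj-nbr₀-complete (suc w) = refl

  IsComposition : ℕ → List ℕ → Set
  IsComposition n J = (sum J ≡ n) × All (0 <_) J

  compsF-sound : ∀ f n → All (IsComposition n) (compsF f n)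
  compsF-sound _       zero    = (refl , []) ∷ []
  compsF-sound zero    (suc m) = []
  compsF-sound (suc f) (suc m) = concat⁺ (map⁺ (applyUpTo⁺₁ (λ k → k) (suc m) (λ {k} k≤m →
      map⁺ (All.map (prepend k≤m) (compsF-sound f (m ∸ k))))))
    where
    prepend : ∀ {k J} → k < suc m → IsComposition (m ∸ k) J → IsComposition (suc m) (suc k ∷ J)
    prepend {k} (s≤s k≤m) (ΣJ≡m∸k , J>0) =
      trans (cong (suc k ℕ.+_) ΣJ≡m∸k) (cong suc (ℕₚ.m+[n∸m]≡n k≤m)) , s≤s z≤n ∷ J>0

  compsF-fuel : ∀ f n → n ≤ f → compsF f n ≡ compositions n
  compsF-fuel zero    zero _   = refl
  compsF-fuel (suc f) n    n≤f with ℕₚ.m≤n⇒m<n∨m≡n n≤f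
  ... | inj₁ (s≤s n≤f′) = trans (moreFuel f n n≤f′) (compsF-fuel f n n≤f′)
    where
    moreFuel : ∀ f n → n ≤ f → compsF (suc f) n ≡ compsF f n
    moreFuel f       zero    _         = refl
    moreFuel (suc f) (suc m) (s≤s m≤f) =
      concatMap-cong (λ k → cong (map (suc k ∷_)) (moreFuel f (m ∸ k) (ℕₚ.≤-trans (m∸n≤m m k) m≤f))) (upTo (suc m))
  ... | inj₂ refl = refl

  compSum : ℕ → (List ℕ → ℤ) → ℤ
  compSum n g = sumℤ (map g (compositions n))

  compSum-cong : ∀ n {g h : List ℕ → ℤ} → (∀ J → IsComposition n J → g J ≡ h J) → compSum n g ≡ compSum n h
  compSum-cong n g≡h = cong sumℤ (map-cong-local (All.map (λ {J} → g≡h J) (compsF-sound n n)))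

  compSum-vanishing : ∀ n (g : List ℕ → ℤ) → (∀ J → IsComposition n J → g J ≡ + 0) → compSum n g ≡ + 0
  compSum-vanishing n g g≡0 = trans (compSum-cong n g≡0) (sumℤ-map-zero (compositions n))

  compSum-+ : ∀ n (g h : List ℕ → ℤ) → compSum n (λ J → g J + h J) ≡ compSum n g + compSum n h
  compSum-+ n g h = sumℤ-map-+ g h (compositions n)

  compSum-*ˡ : ∀ n (c : ℤ) (g : List ℕ → ℤ) → compSum n (λ J → c * g J) ≡ c * compSum n g
  compSum-*ˡ n c g = sumℤ-map-*ˡ c g (compositions n)

  compSum-0 : ∀ (g : List ℕ → ℤ) → compSum 0 g ≡ g []
  compSum-0 g = +-identityʳ (g [])

  compSum-first : ∀ m (g : List ℕ → ℤ) → compSum (suc m) g ≡ sumBelow (suc m) (λ k → compSum (m ∸ k) (λ J → g (suc k ∷ J)))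
  compSum-first m g = begin
      sumℤ (map g (concatMap (λ k → map (suc k ∷_) (compsF m (m ∸ k))) (upTo (suc m))))
    ≡⟨ trans (sumℤ-concatMap g (λ k → map (suc k ∷_) (compsF m (m ∸ k))) (upTo (suc m)))
             (sumℤ-map-upTo (suc m) (λ k → sumℤ (map g (map (suc k ∷_) (compsF m (m ∸ k)))))) ⟩
      sumBelow (suc m) (λ k → sumℤ (map g (map (suc k ∷_) (compsF m (m ∸ k)))))
    ≡⟨ sumBelow-cong (suc m) (λ k k≤m → cong sumℤ (trans (sym (map-∘ {g = g} {f = suc k ∷_} (compsF m (m ∸ k))))
                                                   (cong (map (λ J → g (suc k ∷ J))) (compsF-fuel m (m ∸ k) (m∸n≤m m k))))) ⟩
      sumBelow (suc m) (λ k → compSum (m ∸ k) (λ J → g (suc k ∷ J)))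
    ∎
    where open ≡-Reasoning

  ∸-suc : ∀ {n i} → i < n → n ∸ i ≡ suc (n ∸ suc i)
  ∸-suc i<n = ℕₚ.+-∸-assoc 1 i<n

  compSum-first-∸ : ∀ {n k} → k < n → ∀ (g : List ℕ → ℤ) →
    compSum (n ∸ k) g ≡ sumBelow (n ∸ k) (λ i → compSum (n ∸ suc (k ℕ.+ i)) (λ J → g (suc i ∷ J)))
  compSum-first-∸ {n} {k} k<n g = begin
      compSum (n ∸ k) g
    ≡⟨ cong (λ m → compSum m g) (∸-suc k<n) ⟩
      compSum (suc (n ∸ suc k)) g
    ≡⟨ compSum-first (n ∸ suc k) g ⟩
      sumBelow (suc (n ∸ suc k)) (λ i → compSum (n ∸ suc k ∸ i) (λ J → g (suc i ∷ J)))
    ≡⟨ sumBelow-cong (suc (n ∸ suc k)) (λ i _ → cong (λ m → compSum m (λ J → g (suc i ∷ J))) (ℕₚ.∸-+-assoc n (suc k) i)) ⟩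
      sumBelow (suc (n ∸ suc k)) (λ i → compSum (n ∸ suc (k ℕ.+ i)) (λ J → g (suc i ∷ J)))
    ≡⟨ cong (λ m → sumBelow m (λ i → compSum (n ∸ suc (k ℕ.+ i)) (λ J → g (suc i ∷ J)))) (∸-suc k<n) ⟨
      sumBelow (n ∸ k) (λ i → compSum (n ∸ suc (k ℕ.+ i)) (λ J → g (suc i ∷ J)))
    ∎
    where open ≡-Reasoning

  compSum-∸-self : ∀ n (g : List ℕ → ℤ) → compSum (n ∸ n) g ≡ g []
  compSum-∸-self n g = trans (cong (λ m → compSum m g) (ℕₚ.n∸n≡0 n)) (compSum-0 g)

  compSum-last : ∀ n (g : List ℕ → ℤ) →
    compSum (suc n) g ≡ sumBelow (suc n) (λ k → compSum (n ∸ k) (λ J → g (J ++ [ suc k ])))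
  compSum-last = <-rec _ step
    where
    LastPart : ℕ → Set
    LastPart n = ∀ g → compSum (suc n) g ≡ sumBelow (suc n) (λ k → compSum (n ∸ k) (λ J → g (J ++ [ suc k ])))

    step : ∀ n → (∀ {m} → m < n → LastPart m) → LastPart n
    step n IH g = begin
        compSum (suc n) g
      ≡⟨ trans (compSum-first n g) (sumBelow-last n (λ i → compSum (n ∸ i) (λ J → g (suc i ∷ J)))) ⟩
        sumBelow n (λ i → compSum (n ∸ i) (λ J → g (suc i ∷ J))) + compSum (n ∸ n) (λ J → g (suc n ∷ J))
      ≡⟨ cong₂ _+_ (sumBelow-cong n expandLast) (compSum-∸-self n (λ J → g (suc n ∷ J))) ⟩
        sumBelow n (λ i → sumBelow (n ∸ i) (λ k → G i k)) + g [ suc n ]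
      ≡⟨ cong (_+ g [ suc n ]) (sumBelow-triangle n G) ⟩
        sumBelow n (λ k → sumBelow (n ∸ k) (λ i → G i k)) + g [ suc n ]
      ≡⟨ cong₂ _+_ (sumBelow-cong n expandFirst) (compSum-∸-self n (λ J → g (J ++ [ suc n ]))) ⟨
        sumBelow n (λ k → compSum (n ∸ k) (λ J → g (J ++ [ suc k ]))) + compSum (n ∸ n) (λ J → g (J ++ [ suc n ]))
      ≡⟨ sumBelow-last n (λ k → compSum (n ∸ k) (λ J → g (J ++ [ suc k ]))) ⟨
        sumBelow (suc n) (λ k → compSum (n ∸ k) (λ J → g (J ++ [ suc k ])))
      ∎
      where
      open ≡-Reasoning
      G : ℕ → ℕ → ℤ
      G i k = compSum (n ∸ suc (i ℕ.+ k)) (λ J → g (suc i ∷ (J ++ [ suc k ])))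

      expandLast : ∀ i → i < n → compSum (n ∸ i) (λ J → g (suc i ∷ J)) ≡ sumBelow (n ∸ i) (G i)
      expandLast i i<n =
        trans (cong (λ m → compSum m (λ J → g (suc i ∷ J))) (∸-suc i<n))
          (trans (IH (ℕₚ.∸-monoʳ-< z<s i<n) (λ J → g (suc i ∷ J)))
            (trans (sumBelow-cong (suc (n ∸ suc i))
                     (λ k _ → cong (λ m → compSum m (λ J → g (suc i ∷ (J ++ [ suc k ])))) (ℕₚ.∸-+-assoc n (suc i) k)))
              (cong (λ m → sumBelow m (G i)) (sym (∸-suc i<n)))))

      expandFirst : ∀ k → k < n → compSum (n ∸ k) (λ J → g (J ++ [ suc k ])) ≡ sumBelow (n ∸ k) (λ i → G i k)
      expandFirst k k<n = trans (compSum-first-∸ k<n (λ J → g (J ++ [ suc k ])))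
        (sumBelow-cong (n ∸ k) (λ i _ → cong (λ m → compSum (n ∸ suc m) (λ J → g (suc i ∷ (J ++ [ suc k ])))) (ℕₚ.+-comm k i)))

  compSum-single : ∀ m (g : List ℕ → ℤ) →
    (∀ j₁ j₂ K → IsComposition (suc m) (j₁ ∷ j₂ ∷ K) → g (j₁ ∷ j₂ ∷ K) ≡ + 0) → compSum (suc m) g ≡ g [ suc m ]
  compSum-single m g g≡0 = begin
      compSum (suc m) g
    ≡⟨ trans (compSum-first m g) (sumBelow-last m (λ k → compSum (m ∸ k) (λ J → g (suc k ∷ J)))) ⟩
      sumBelow m (λ k → compSum (m ∸ k) (λ J → g (suc k ∷ J))) + compSum (m ∸ m) (λ J → g (suc m ∷ J))
    ≡⟨ cong₂ _+_ (trans (sumBelow-cong m (λ k k<m → compSum-vanishing (m ∸ k) _ (tails k k<m))) (sumBelow-zero m))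
                 (compSum-∸-self m (λ J → g (suc m ∷ J))) ⟩
      + 0 + g [ suc m ]
    ≡⟨ +-identityˡ _ ⟩
      g [ suc m ]
    ∎
    where
    open ≡-Reasoning
    tails : ∀ k → k < m → ∀ J → IsComposition (m ∸ k) J → g (suc k ∷ J) ≡ + 0
    tails k k<m []      (ΣJ≡m∸k , _)   = contradiction (trans ΣJ≡m∸k (∸-suc k<m)) (λ ())
    tails k k<m (j ∷ J) (ΣJ≡m∸k , J>0) =
      g≡0 (suc k) j J (trans (cong (suc k ℕ.+_) ΣJ≡m∸k) (cong suc (ℕₚ.m+[n∸m]≡n (ℕₚ.<⇒≤ k<m))) , s≤s z≤n ∷ J>0)

  coef : ℕ → ℕ → List ℕ → ℤ
  coef a c I = + coef₁ a c I + + coef₂ a c I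

  lastPart-snoc : ∀ J L → lastPart (J ++ [ L ]) ≡ L
  lastPart-snoc []           L = refl
  lastPart-snoc (j ∷ [])     L = refl
  lastPart-snoc (j ∷ j′ ∷ J) L = lastPart-snoc (j′ ∷ J) L

  lastPart-pos : ∀ {j J} → All (0 <_) (j ∷ J) → 0 < lastPart (j ∷ J)
  lastPart-pos (j>0 ∷ [])         = j>0
  lastPart-pos (_ ∷ J>0@(_ ∷ _)) = lastPart-pos J>0

  coef-guard : ∀ a c I → coef a c I ≡ (if a ≤ᵇ lastPart I then coef 0 c I else + 0)
  coef-guard a c [] with a ≤ᵇ 0
  ... | true  = refl
  ... | false = refl
  coef-guard a c (i ∷ []) with a ≤ᵇ i
  ... | true  = refl
  ... | false = refl
  coef-guard a c (i₁ ∷ i₂ ∷ I) with a ≤ᵇ lastPart (i₂ ∷ I)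
  ... | true  = refl
  ... | false = refl

  coef-snoc-guard : ∀ {a L b} c → (a ≤ᵇ L) ≡ b → ∀ J → coef a c (J ++ [ L ]) ≡ (if b then coef 0 c (J ++ [ L ]) else + 0)
  coef-snoc-guard {a} {L} c refl J =
    trans (coef-guard a c (J ++ [ L ])) (cong (λ n → if a ≤ᵇ n then coef 0 c (J ++ [ L ]) else + 0) (lastPart-snoc J L))

  coef-1≡0 : ∀ c I → All (0 <_) I → coef 1 c I ≡ coef 0 c I
  coef-1≡0 c []      _   = refl
  coef-1≡0 c (i ∷ I) I>0 =
    trans (coef-guard 1 c (i ∷ I)) (cong (λ b → if b then coef 0 c (i ∷ I) else + 0) (≤ᵇ-true (lastPart-pos I>0)))

  coef-small : ∀ a c I → sum I ≤ c → coef a c I ≡ + 0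
  coef-small a c []           _ = refl
  coef-small a c (j ∷ [])     ΣI≤c
    rewrite ≤ᵇ-false {suc c} {j} (s≤s (ℕₚ.m+n≤o⇒m≤o j ΣI≤c)) | ∧-zeroʳ (a ≤ᵇ j) = refl
  coef-small a c (j ∷ j₂ ∷ K) ΣI≤c
    rewrite ≤ᵇ-false {suc c} {j} (s≤s (ℕₚ.m+n≤o⇒m≤o j ΣI≤c))
          | <ᵇ-false {c} {j₂} (ℕₚ.m+n≤o⇒m≤o j₂ (ℕₚ.m+n≤o⇒n≤o j ΣI≤c))
          | ∧-zeroʳ (j ≤ᵇ c) | ∧-zeroʳ (a ≤ᵇ lastPart (j₂ ∷ K)) = refl

  prodℕ-map-pred-snoc : ∀ J L → prodℕ (map pred (J ++ [ L ])) ≡ prodℕ (map pred J) ℕ.* pred L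
  prodℕ-map-pred-snoc []      L = trans (ℕₚ.*-identityʳ (pred L)) (sym (ℕₚ.*-identityˡ (pred L)))
  prodℕ-map-pred-snoc (j ∷ J) L = trans (cong (pred j ℕ.*_) (prodℕ-map-pred-snoc J L)) (sym (ℕₚ.*-assoc (pred j) _ (pred L)))

  if-*ʳ : ∀ (b : Bool) m n → (if b then m ℕ.* n else 0) ≡ (if b then m else 0) ℕ.* n
  if-*ʳ false m n = refl
  if-*ʳ true  m n = refl

  coef₁-snoc : ∀ c j J L → coef₁ 0 c ((j ∷ J) ++ [ L ]) ≡ coef₁ 0 c (j ∷ J) ℕ.* pred L
  coef₁-snoc c j J L =
    trans (cong (λ w → if suc c ≤ᵇ j then w else 0)
            (trans (cong (j ℕ.*_) (prodℕ-map-pred-snoc J L)) (sym (ℕₚ.*-assoc j _ (pred L)))))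
      (if-*ʳ (suc c ≤ᵇ j) _ (pred L))

  coef₂-snoc : ∀ c j₁ j₂ K L → coef₂ 0 c ((j₁ ∷ j₂ ∷ K) ++ [ L ]) ≡ coef₂ 0 c (j₁ ∷ j₂ ∷ K) ℕ.* pred L
  coef₂-snoc c j₁ j₂ K L =
    trans (cong (λ w → if (j₁ ≤ᵇ c) ∧ (c <ᵇ j₂) then w else 0)
            (trans (cong ((j₂ ∸ j₁) ℕ.*_) (prodℕ-map-pred-snoc K L)) (sym (ℕₚ.*-assoc (j₂ ∸ j₁) _ (pred L)))))
      (if-*ʳ ((j₁ ≤ᵇ c) ∧ (c <ᵇ j₂)) _ (pred L))

  pairCoef : ℕ → ℕ → List ℕ → ℤ
  pairCoef c L (j ∷ []) = + coef₂ 0 c (j ∷ L ∷ [])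
  pairCoef c L _        = + 0

  coef-snoc : ∀ c L j J → coef 0 c ((j ∷ J) ++ [ L ]) ≡ + pred L * coef 0 c (j ∷ J) + pairCoef c L (j ∷ J)
  coef-snoc c L j [] =
    cong (_+ pairCoef c L [ j ])
      (trans (cong +_ (trans (coef₁-snoc c j [] L) (ℕₚ.*-comm _ (pred L))))
        (trans (pos-* (pred L) _) (cong (+ pred L *_) (sym (+-identityʳ _)))))
  coef-snoc c L j (j₂ ∷ K) =
    trans (cong₂ (λ s t → + s + + t) (coef₁-snoc c j (j₂ ∷ K) L) (coef₂-snoc c j j₂ K L))
      (trans (cong +_ (sym (trans (ℕₚ.*-comm (pred L) _)
                                  (ℕₚ.*-distribʳ-+ (pred L) (coef₁ 0 c (j ∷ j₂ ∷ K)) (coef₂ 0 c (j ∷ j₂ ∷ K))))))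
        (trans (pos-* (pred L) _) (sym (+-identityʳ _))))

  prodℤ-snoc : ∀ (J : List ℤ) L → prodℤ (J ++ [ L ]) ≡ prodℤ J * L
  prodℤ-snoc []      L = trans (*-identityʳ L) (sym (*-identityˡ L))
  prodℤ-snoc (j ∷ J) L = trans (cong (j *_) (prodℤ-snoc J L)) (sym (*-assoc j _ L))

  eComp-snoc : ∀ N (x : Fin N → ℤ) J L → eComp N x (J ++ [ L ]) ≡ eComp N x J * esym N x L
  eComp-snoc N x J L = trans (cong prodℤ (map-++ (esym N x) J [ L ])) (prodℤ-snoc (map (esym N x) J) (esym N x L))

  module _ (N : ℕ) (x : Fin N → ℤ) where

    e : ℕ → ℤ
    e = esym N x

    ê : ℕ → Fin N → ℤ
    ê k j = esym N (zeroAt x j) k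

    -- c! · tailWeight b c j is the weighted number of colourings of s₁, …, s_b, t₁, …, t_c
    -- compatible with colour j on r_a.
    tailWeight : ℕ → ℕ → Fin N → ℤ
    tailWeight zero    c j = ê c j
    tailWeight (suc b) c i = ∑[ j < N ] (zeroAt x i j * tailWeight b c j)

    reducedChrom : ℕ → ℕ → ℕ → ℤ
    reducedChrom A b c = ∑[ j < N ] (x j * ê A j * tailWeight b c j)

    reducedChrom-path-suc : ∀ A b c →
      reducedChrom A (suc b) c ≡ + A * e (suc A) * reducedChrom 0 b c + reducedChrom (suc A) b c
    reducedChrom-path-suc A b c = begin
        ∑[ i < N ] (x i * ê A i * tailWeight (suc b) c i)
      ≡⟨ sum-cong-≗ {N} (λ i → cong (x i * ê A i *_) (sum-zeroAt x (tailWeight b c) i)) ⟩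
        ∑[ i < N ] (x i * ê A i * (S - x i * T i))
      ≡⟨ sum-cong-≗ {N} pointwise ⟩
        ∑[ i < N ] ((S * (x i * ê A i) - e (suc A) * (x i * T i)) + x i * ê (suc A) i * T i)
      ≡⟨ trans (∑-distrib-+ {N} (λ i → S * (x i * ê A i) - e (suc A) * (x i * T i)) (λ i → x i * ê (suc A) i * T i))
           (cong (_+ reducedChrom (suc A) b c)
             (trans (∑-distrib-sub (λ i → S * (x i * ê A i)) (λ i → e (suc A) * (x i * T i)))
               (cong₂ _-_ (sym (*-distribˡ-sum S (λ i → x i * ê A i))) (sym (*-distribˡ-sum (e (suc A)) (λ i → x i * T i)))))) ⟩
        (S * ∑[ i < N ] (x i * ê A i) - e (suc A) * S) + reducedChrom (suc A) b c
      ≡⟨ cong (λ t → (S * t - e (suc A) * S) + reducedChrom (suc A) b c) (esym-euler N x A) ⟩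
        (S * (+ suc A * e (suc A)) - e (suc A) * S) + reducedChrom (suc A) b c
      ≡⟨ cong (_+ reducedChrom (suc A) b c)
           (solve 3 (λ s a f → s :* ((con (+ 1) :+ a) :* f) :- f :* s := a :* f :* s) refl S (+ A) (e (suc A))) ⟩
        + A * e (suc A) * S + reducedChrom (suc A) b c
      ≡⟨ cong (λ t → + A * e (suc A) * t + reducedChrom (suc A) b c)
           (sum-cong-≗ {N} (λ j → cong (_* T j) (sym (*-identityʳ (x j))))) ⟩
        + A * e (suc A) * reducedChrom 0 b c + reducedChrom (suc A) b c
      ∎
      where
      open ≡-Reasoning
      T : Fin N → ℤ
      T = tailWeight b c
      S : ℤ
      S = ∑[ j < N ] (x j * T j)
      pointwise : ∀ i → x i * ê A i * (S - x i * T i)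
                      ≡ (S * (x i * ê A i) - e (suc A) * (x i * T i)) + x i * ê (suc A) i * T i
      pointwise i rewrite esym-pascal N x i A =
        solve 5 (λ p q r u s → p :* q :* (s :- p :* r) := (s :* (p :* q) :- (p :* q :+ u) :* (p :* r)) :+ p :* u :* r) refl
          (x i) (ê A i) (T i) (ê (suc A) i) S

    reducedChrom-tail-zero : ∀ A → reducedChrom A 0 0 ≡ + suc A * e (suc A)
    reducedChrom-tail-zero A = trans (sum-cong-≗ {N} (λ j → *-identityʳ (x j * ê A j))) (esym-euler N x A)

    reducedChrom-tail-suc : ∀ A c → reducedChrom A 0 (suc c) ≡ reducedChrom (suc A) 0 c + (+ A - + c) * e (suc A) * e (suc c)
    reducedChrom-tail-suc A c = begin
        ∑[ j < N ] (x j * ê A j * ê (suc c) j)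
      ≡⟨ sum-cong-≗ {N} pointwise ⟩
        ∑[ j < N ] ((e (suc c) * (x j * ê A j) - e (suc A) * (x j * ê c j)) + x j * ê (suc A) j * ê c j)
      ≡⟨ trans (∑-distrib-+ {N} (λ j → e (suc c) * (x j * ê A j) - e (suc A) * (x j * ê c j)) (λ j → x j * ê (suc A) j * ê c j))
           (cong (_+ reducedChrom (suc A) 0 c)
             (trans (∑-distrib-sub (λ j → e (suc c) * (x j * ê A j)) (λ j → e (suc A) * (x j * ê c j)))
               (cong₂ _-_ (sym (*-distribˡ-sum (e (suc c)) (λ j → x j * ê A j)))
                          (sym (*-distribˡ-sum (e (suc A)) (λ j → x j * ê c j)))))) ⟩
        (e (suc c) * ∑[ j < N ] (x j * ê A j) - e (suc A) * ∑[ j < N ] (x j * ê c j)) + reducedChrom (suc A) 0 c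
      ≡⟨ cong₂ (λ s t → (e (suc c) * s - e (suc A) * t) + reducedChrom (suc A) 0 c) (esym-euler N x A) (esym-euler N x c) ⟩
        (e (suc c) * (+ suc A * e (suc A)) - e (suc A) * (+ suc c * e (suc c))) + reducedChrom (suc A) 0 c
      ≡⟨ solve 5 (λ f g a k h → (f :* ((con (+ 1) :+ a) :* g) :- g :* ((con (+ 1) :+ k) :* f)) :+ h := h :+ (a :- k) :* g :* f) refl
           (e (suc c)) (e (suc A)) (+ A) (+ c) (reducedChrom (suc A) 0 c) ⟩
        reducedChrom (suc A) 0 c + (+ A - + c) * e (suc A) * e (suc c)
      ∎
      where
      open ≡-Reasoning
      pointwise : ∀ j → x j * ê A j * ê (suc c) j
                      ≡ (e (suc c) * (x j * ê A j) - e (suc A) * (x j * ê c j)) + x j * ê (suc A) j * ê c j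
      pointwise j rewrite esym-pascal N x j A | esym-pascal N x j c =
        solve 5 (λ p q u v w → p :* q :* w := ((p :* v :+ w) :* (p :* q) :- (p :* q :+ u) :* (p :* v)) :+ p :* u :* v) refl
          (x j) (ê A j) (ê (suc A) j) (ê c j) (ê (suc c) j)

    cliqueWeights : ℕ → (Fin N → ℤ) → ℕ → Fin N → ℤ
    cliqueWeights a z v j = if v <ᵇ a then z j else x j

    barbellChrom : ℕ → ℕ → ℕ → (Fin N → ℤ) → ℤ
    barbellChrom a b c z = weightedChrom (a ℕ.+ b ℕ.+ c) N (barbellAdjℕ a b) (cliqueWeights a z)

    barbellChrom-peel-clique : ∀ a b c z → barbellChrom (suc (suc a)) b c z ≡ ∑[ i < N ] (z i * barbellChrom (suc a) b c (zeroAt z i))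
    barbellChrom-peel-clique a b c z =
      trans (weightedChrom-peel (suc a ℕ.+ b ℕ.+ c) N (barbellAdjℕ (suc (suc a)) b) (cliqueWeights (suc (suc a)) z) refl)
        (sum-cong-≗ {N} (λ i → cong (z i *_) (weightedChrom-cong (suc a ℕ.+ b ℕ.+ c) N
          (λ u v → barbellAdjℕ (suc (suc a)) b (suc u) (suc v)) (barbellAdjℕ (suc a) b)
          (peelWeights (barbellAdjℕ (suc (suc a)) b) (cliqueWeights (suc (suc a)) z) i) (cliqueWeights (suc a) (zeroAt z i))
          (λ u v → barbellAdj-shift-clique a b (toℕ u) (toℕ v))
          (λ v j → trans (cong (λ p → if p ∧ does (j ≟ i) then + 0 else cliqueWeights (suc a) z (toℕ v) j)
                               (barbellAdj-nbr₀-clique a b (toℕ v)))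
                         (clique-if (toℕ v <ᵇ suc a) (does (j ≟ i)))))))
      where
      clique-if : ∀ {s t : ℤ} p d → (if p ∧ d then + 0 else (if p then s else t)) ≡ (if p then (if d then + 0 else s) else t)
      clique-if false d = refl
      clique-if true  d = refl

    barbellChrom-peel-path : ∀ b c z → barbellChrom 1 (suc b) c z ≡ ∑[ i < N ] (z i * barbellChrom 1 b c (zeroAt x i))
    barbellChrom-peel-path b c z =
      trans (weightedChrom-peel (suc (b ℕ.+ c)) N (barbellAdjℕ 1 (suc b)) (cliqueWeights 1 z) refl)
        (sum-cong-≗ {N} (λ i → cong (z i *_) (weightedChrom-cong (suc (b ℕ.+ c)) N
          (λ u v → barbellAdjℕ 1 (suc b) (suc u) (suc v)) (barbellAdjℕ 1 b)
          (peelWeights (barbellAdjℕ 1 (suc b)) (cliqueWeights 1 z) i) (cliqueWeights 1 (zeroAt x i))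
          (λ u v → barbellAdj-shift-path b (toℕ u) (toℕ v))
          (λ v j → trans (cong (λ p → if p ∧ does (j ≟ i) then + 0 else x j) (barbellAdj-nbr₀-path b (toℕ v)))
                         (path-if (toℕ v <ᵇ 1) (does (j ≟ i)))))))
      where
      path-if : ∀ {t : ℤ} p d → (if p ∧ d then + 0 else t) ≡ (if p then (if d then + 0 else t) else t)
      path-if false d = refl
      path-if true  d = refl

    barbellChrom-peel-bridge : ∀ c z →
      barbellChrom 1 0 c z ≡ ∑[ i < N ] (z i * weightedChrom c N (λ u v → not (u ≡ᵇ v)) (λ _ → zeroAt x i))
    barbellChrom-peel-bridge c z =
      trans (weightedChrom-peel c N (barbellAdjℕ 1 0) (cliqueWeights 1 z) refl)
        (sum-cong-≗ {N} (λ i → cong (z i *_) (weightedChrom-cong c N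
          (λ u v → barbellAdjℕ 1 0 (suc u) (suc v)) (λ u v → not (u ≡ᵇ v))
          (peelWeights (barbellAdjℕ 1 0) (cliqueWeights 1 z) i) (λ _ → zeroAt x i)
          (λ u v → barbellAdj-shift-complete (toℕ u) (toℕ v))
          (λ v j → cong (λ p → if p ∧ does (j ≟ i) then + 0 else x j) (barbellAdj-nbr₀-complete (toℕ v))))))

    barbellChrom-1 : ∀ b c z → barbellChrom 1 b c z ≡ + (c !) * ∑[ j < N ] (z j * tailWeight b c j)
    barbellChrom-1 zero c z =
      trans (barbellChrom-peel-bridge c z)
        (trans (sum-cong-≗ {N} (λ i → trans (cong (z i *_) (weightedChrom-complete c N (zeroAt x i)))
                                         (solve 3 (λ a b d → a :* (b :* d) := b :* (a :* d)) refl (z i) (+ (c !)) (ê c i))))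
          (sym (*-distribˡ-sum (+ (c !)) (λ j → z j * tailWeight zero c j))))
    barbellChrom-1 (suc b) c z =
      trans (barbellChrom-peel-path b c z)
        (trans (sum-cong-≗ {N} (λ i → trans (cong (z i *_) (barbellChrom-1 b c (zeroAt x i)))
                                         (solve 3 (λ a b d → a :* (b :* d) := b :* (a :* d)) refl (z i) (+ (c !)) (tailWeight (suc b) c i))))
          (sym (*-distribˡ-sum (+ (c !)) (λ j → z j * tailWeight (suc b) c j))))

    barbellChrom-clique : ∀ A b c z →
      barbellChrom (suc A) b c z ≡ + (A !) * + (c !) * ∑[ j < N ] (z j * esym N (zeroAt z j) A * tailWeight b c j)
    barbellChrom-clique zero b c z =
      trans (barbellChrom-1 b c z)
        (cong₂ _*_ (sym (*-identityˡ (+ (c !)))) (sum-cong-≗ {N} (λ j → cong (_* tailWeight b c j) (sym (*-identityʳ (z j))))))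
    barbellChrom-clique (suc A) b c z = begin
        barbellChrom (suc (suc A)) b c z
      ≡⟨ barbellChrom-peel-clique A b c z ⟩
        ∑[ i < N ] (z i * barbellChrom (suc A) b c (zeroAt z i))
      ≡⟨ sum-cong-≗ {N} (λ i → trans (cong (z i *_) (barbellChrom-clique A b c (zeroAt z i)))
                                   (solve 3 (λ p q r → p :* (q :* r) := q :* (p :* r)) refl (z i) C _)) ⟩
        ∑[ i < N ] (C * (z i * ∑[ j < N ] (zeroAt z i j * esym N (zeroAt (zeroAt z i) j) A * T j)))
      ≡⟨ trans (sym (*-distribˡ-sum C (λ i → z i * ∑[ j < N ] (zeroAt z i j * esym N (zeroAt (zeroAt z i) j) A * T j))))
               (cong (C *_) (esym-euler-nested N z T A)) ⟩
        C * (+ suc A * ∑[ j < N ] (z j * esym N (zeroAt z j) (suc A) * T j))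
      ≡⟨ sym (*-assoc C (+ suc A) _) ⟩
        C * + suc A * ∑[ j < N ] (z j * esym N (zeroAt z j) (suc A) * T j)
      ≡⟨ cong (_* ∑[ j < N ] (z j * esym N (zeroAt z j) (suc A) * T j))
           (trans (solve 3 (λ p q s → p :* q :* s := s :* p :* q) refl (+ (A !)) (+ (c !)) (+ suc A))
             (cong (_* + (c !)) (sym (pos-* (suc A) (A !))))) ⟩
        + (suc A !) * + (c !) * ∑[ j < N ] (z j * esym N (zeroAt z j) (suc A) * T j)
      ∎
      where
      open ≡-Reasoning
      C : ℤ
      C = + (A !) * + (c !)
      T : Fin N → ℤ
      T = tailWeight b c

    chromSym-barbell : ∀ A b c → chromSym (barbell (suc A) b c) N x ≡ + (A !) * + (c !) * reducedChrom A b c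
    chromSym-barbell A b c =
      trans (weightedChrom-cong (suc A ℕ.+ b ℕ.+ c) N (barbellAdjℕ (suc A) b) (barbellAdjℕ (suc A) b) (λ _ → x) (cliqueWeights (suc A) x)
               (λ u v → refl) (λ v j → if-same (toℕ v <ᵇ suc A)))
        (barbellChrom-clique A b c x)
      where
      if-same : ∀ {t : ℤ} p → t ≡ (if p then t else t)
      if-same false = refl
      if-same true  = refl

    term : ℕ → ℕ → List ℕ → ℤ
    term a c I = coef a c I * eComp N x I

    eSum : ℕ → ℕ → ℕ → ℤ
    eSum a c n = compSum n (term a c)

    lastSum : ℕ → ℕ → ℕ → ℕ → ℤ
    lastSum a c L m = compSum m (λ J → term a c (J ++ [ L ]))

    lastSum-guard : ∀ a c L m → lastSum a c L m ≡ (if a ≤ᵇ L then lastSum 0 c L m else + 0)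
    lastSum-guard a c L m with a ≤ᵇ L in a≤ᵇL
    ... | true  = compSum-cong m (λ J _ → cong (_* eComp N x (J ++ [ L ])) (coef-snoc-guard c a≤ᵇL J))
    ... | false = compSum-vanishing m _ (λ J _ →
      trans (cong (_* eComp N x (J ++ [ L ])) (coef-snoc-guard c a≤ᵇL J)) (*-zeroˡ (eComp N x (J ++ [ L ]))))

    eSum-expand : ∀ A c n →
      eSum (suc A) c (suc n) ≡ sumBelow (suc n) (λ k → if A ≤ᵇ k then lastSum 0 c (suc k) (n ∸ k) else + 0)
    eSum-expand A c n = trans (compSum-last n (term (suc A) c))
      (sumBelow-cong (suc n) (λ k _ → trans (lastSum-guard (suc A) c (suc k) (n ∸ k))
        (cong (λ b → if b then lastSum 0 c (suc k) (n ∸ k) else + 0) (<ᵇ-suc A k))))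

    eSum-small : ∀ a c m → m ≤ c → eSum a c m ≡ + 0
    eSum-small a c m m≤c = compSum-vanishing m (term a c)
      (λ J (ΣJ≡m , _) → trans (cong (_* eComp N x J) (coef-small a c J (subst (_≤ c) (sym ΣJ≡m) m≤c))) (*-zeroˡ (eComp N x J)))

    lastSum-suc : ∀ c L m → lastSum 0 c L (suc m) ≡ e L * (+ pred L * eSum 1 c (suc m) + pairCoef c L [ suc m ] * e (suc m))
    lastSum-suc c L m = begin
        compSum (suc m) (λ J → term 0 c (J ++ [ L ]))
      ≡⟨ compSum-cong (suc m) split ⟩
        compSum (suc m) (λ J → e L * (+ pred L * term 1 c J + pairCoef c L J * eComp N x J))
      ≡⟨ trans (compSum-*ˡ (suc m) (e L) _) (cong (e L *_) (compSum-+ (suc m) _ _)) ⟩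
        e L * (compSum (suc m) (λ J → + pred L * term 1 c J) + compSum (suc m) (λ J → pairCoef c L J * eComp N x J))
      ≡⟨ cong (λ t → e L * t) (cong₂ _+_ (compSum-*ˡ (suc m) (+ pred L) (term 1 c))
           (trans (compSum-single m _ (λ j₁ j₂ K _ → *-zeroˡ (eComp N x (j₁ ∷ j₂ ∷ K))))
                  (cong (pairCoef c L [ suc m ] *_) (*-identityʳ (e (suc m)))))) ⟩
        e L * (+ pred L * eSum 1 c (suc m) + pairCoef c L [ suc m ] * e (suc m))
      ∎
      where
      open ≡-Reasoning
      split : ∀ J → IsComposition (suc m) J → term 0 c (J ++ [ L ]) ≡ e L * (+ pred L * term 1 c J + pairCoef c L J * eComp N x J)
      split []      (() , _)
      split (j ∷ J) (_ , J>0) = begin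
          coef 0 c ((j ∷ J) ++ [ L ]) * eComp N x ((j ∷ J) ++ [ L ])
        ≡⟨ cong₂ _*_ (coef-snoc c L j J) (eComp-snoc N x (j ∷ J) L) ⟩
          (+ pred L * coef 0 c (j ∷ J) + pairCoef c L (j ∷ J)) * (eComp N x (j ∷ J) * e L)
        ≡⟨ cong (λ t → (+ pred L * t + pairCoef c L (j ∷ J)) * (eComp N x (j ∷ J) * e L)) (sym (coef-1≡0 c (j ∷ J) J>0)) ⟩
          (+ pred L * coef 1 c (j ∷ J) + pairCoef c L (j ∷ J)) * (eComp N x (j ∷ J) * e L)
        ≡⟨ solve 5 (λ p q s E f → (p :* q :+ s) :* (E :* f) := f :* (p :* (q :* E) :+ s :* E)) refl
             (+ pred L) (coef 1 c (j ∷ J)) (pairCoef c L (j ∷ J)) (eComp N x (j ∷ J)) (e L) ⟩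
          e L * (+ pred L * term 1 c (j ∷ J) + pairCoef c L (j ∷ J) * eComp N x (j ∷ J))
        ∎

    eSum-threshold-step : ∀ A c n → A ≤ n → eSum (suc A) c (suc n) ≡ eSum (suc (suc A)) c (suc n) + lastSum 0 c (suc A) (n ∸ A)
    eSum-threshold-step A c n A≤n =
      trans (eSum-expand A c n)
        (trans (sumBelow-threshold (λ k → lastSum 0 c (suc k) (n ∸ k)) (s≤s A≤n))
          (cong (_+ lastSum 0 c (suc A) (n ∸ A)) (sym (eSum-expand (suc A) c n))))

    eSum-path-step : ∀ A c m → c < suc m →
      eSum (suc A) c (suc (A ℕ.+ suc m)) ≡ + A * e (suc A) * eSum 1 c (suc m) + eSum (suc (suc A)) c (suc (A ℕ.+ suc m))
    eSum-path-step A c m c<1+m = begin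
        eSum (suc A) c (suc n)
      ≡⟨ eSum-threshold-step A c n (ℕₚ.m≤m+n A (suc m)) ⟩
        eSum (suc (suc A)) c (suc n) + lastSum 0 c (suc A) (n ∸ A)
      ≡⟨ cong (λ k → eSum (suc (suc A)) c (suc n) + lastSum 0 c (suc A) k) (ℕₚ.m+n∸m≡n A (suc m)) ⟩
        eSum (suc (suc A)) c (suc n) + lastSum 0 c (suc A) (suc m)
      ≡⟨ cong (_+_ (eSum (suc (suc A)) c (suc n))) (lastSum-suc c (suc A) m) ⟩
        eSum (suc (suc A)) c (suc n) + e (suc A) * (+ A * eSum 1 c (suc m) + pairCoef c (suc A) [ suc m ] * e (suc m))
      ≡⟨ cong (λ t → eSum (suc (suc A)) c (suc n) + e (suc A) * (+ A * eSum 1 c (suc m) + t * e (suc m))) pairCoef≡0 ⟩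
        eSum (suc (suc A)) c (suc n) + e (suc A) * (+ A * eSum 1 c (suc m) + + 0 * e (suc m))
      ≡⟨ solve 4 (λ s f a t → s :+ f :* (a :* t :+ con (+ 0) :* con (+ 0)) := a :* f :* t :+ s) refl
           (eSum (suc (suc A)) c (suc n)) (e (suc A)) (+ A) (eSum 1 c (suc m)) ⟩
        + A * e (suc A) * eSum 1 c (suc m) + eSum (suc (suc A)) c (suc n)
      ∎
      where
      open ≡-Reasoning
      n : ℕ
      n = A ℕ.+ suc m
      pairCoef≡0 : pairCoef c (suc A) [ suc m ] ≡ + 0
      pairCoef≡0 rewrite ≤ᵇ-false {suc m} {c} c<1+m = refl

    eSum-beyond : ∀ A c → eSum (suc (suc A)) c (suc A) ≡ + 0
    eSum-beyond A c = trans (eSum-expand (suc A) c A) (sumBelow-beyond (suc A) (λ k → lastSum 0 c (suc k) (A ∸ k)))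

    lastSum-small : ∀ c L m → m ≤ c → lastSum 0 c L m ≡ (if c <ᵇ L then + (L ∸ m) * e L * e m else + 0)
    lastSum-small c L zero _ with c <ᵇ L
    ... | true  rewrite ℕₚ.*-identityʳ L =
      solve 2 (λ l f → (l :+ con (+ 0)) :* (f :* con (+ 1)) :+ con (+ 0) := l :* f :* con (+ 1)) refl (+ L) (e L)
    ... | false = cong (_+ + 0) (*-zeroˡ (e L * + 1))
    lastSum-small c L (suc p) 1+p≤c
      rewrite lastSum-suc c L p | eSum-small 1 c (suc p) 1+p≤c | ≤ᵇ-true 1+p≤c with c <ᵇ L
    ... | true  rewrite ℕₚ.*-identityʳ (L ∸ suc p) =
      solve 4 (λ f q d g → f :* (q :* con (+ 0) :+ d :* g) := d :* f :* g) refl (e L) (+ pred L) (+ (L ∸ suc p)) (e (suc p))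
    ... | false = solve 3 (λ f q g → f :* (q :* con (+ 0) :+ con (+ 0) :* g) := con (+ 0)) refl (e L) (+ pred L) (e (suc p))

    eSum-tail-zero : ∀ A → eSum (suc A) 0 (suc A) ≡ + suc A * e (suc A)
    eSum-tail-zero A = begin
        eSum (suc A) 0 (suc A)
      ≡⟨ eSum-threshold-step A 0 A ℕₚ.≤-refl ⟩
        eSum (suc (suc A)) 0 (suc A) + lastSum 0 0 (suc A) (A ∸ A)
      ≡⟨ cong₂ _+_ (eSum-beyond A 0) (cong (lastSum 0 0 (suc A)) (ℕₚ.n∸n≡0 A)) ⟩
        + 0 + lastSum 0 0 (suc A) 0
      ≡⟨ trans (+-identityˡ _) (lastSum-small 0 (suc A) 0 z≤n) ⟩
        + suc A * e (suc A) * + 1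
      ≡⟨ *-identityʳ _ ⟩
        + suc A * e (suc A)
      ∎
      where open ≡-Reasoning

    -- (i₂ − i₁) e_{i₁} e_{i₂} for the composition (i₁, i₂) = (n − k, k + 1) of n + 1; for k = n it is
    -- the term (n + 1) e_{n+1} of the one-part composition.
    pairWeight : ℕ → ℕ → ℤ
    pairWeight n k = + (suc k ∸ (n ∸ k)) * e (suc k) * e (n ∸ k)

    pairWeight-diag : ∀ p q → q ≤ p → pairWeight (p ℕ.+ suc q) p ≡ (+ p - + q) * e (suc p) * e (suc q)
    pairWeight-diag p q q≤p rewrite ℕₚ.m+n∸m≡n p (suc q) = cong (λ t → t * e (suc p) * e (suc q)) (pos-∸ q≤p)

    thresholdSum : ℕ → ℕ → ℤ
    thresholdSum n M = sumBelow (suc n) (λ k → if M ≤ᵇ k then pairWeight n k else + 0)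

    thresholdSum-step : ∀ {n M} → M ≤ n → thresholdSum n M ≡ thresholdSum n (suc M) + pairWeight n M
    thresholdSum-step {n} M≤n = sumBelow-threshold (pairWeight n) (s≤s M≤n)

    eSum-tail-expand : ∀ A c n → n ≤ A ℕ.+ c → eSum (suc A) c (suc n) ≡ thresholdSum n (A ⊔ c)
    eSum-tail-expand A c n n≤A+c = trans (eSum-expand A c n) (sumBelow-cong (suc n) pointwise)
      where
      pointwise : ∀ k → k < suc n →
        (if A ≤ᵇ k then lastSum 0 c (suc k) (n ∸ k) else + 0) ≡ (if A ⊔ c ≤ᵇ k then pairWeight n k else + 0)
      pointwise k _ rewrite sym (≤ᵇ-∧-⊔ A c k) with A ≤ᵇ k in A≤ᵇk
      ... | false = refl
      ... | true  = trans (lastSum-small c (suc k) (n ∸ k) n∸k≤c) (cong (λ b → if b then pairWeight n k else + 0) (<ᵇ-suc c k))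
        where
        n∸k≤c : n ∸ k ≤ c
        n∸k≤c = ℕₚ.m≤n+o⇒m∸n≤o n k (ℕₚ.≤-trans n≤A+c (ℕₚ.+-monoˡ-≤ c (≤ᵇ-true⁻¹ A≤ᵇk)))

    thresholdSum-⊔ : ∀ A c →
      thresholdSum (A ℕ.+ suc c) (A ⊔ suc c) ≡ thresholdSum (A ℕ.+ suc c) (suc A ⊔ c) + (+ A - + c) * e (suc A) * e (suc c)
    thresholdSum-⊔ A c with ℕₚ.<-cmp A c
    ... | tri< A<c _ _ = begin
        S (A ⊔ suc c)
      ≡⟨ cong S (ℕₚ.m≤n⇒m⊔n≡n (ℕₚ.m≤n⇒m≤1+n (ℕₚ.<⇒≤ A<c))) ⟩
        S (suc c)
      ≡⟨ solve 5 (λ s a k f g → s := (s :+ (k :- a) :* f :* g) :+ (a :- k) :* g :* f) refl (S (suc c)) (+ A) (+ c) (e (suc c)) (e (suc A)) ⟩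
        (S (suc c) + (+ c - + A) * e (suc c) * e (suc A)) + D
      ≡⟨ cong (λ t → (S (suc c) + t) + D)
           (trans (cong (λ m → pairWeight m c) (trans (ℕₚ.+-comm A (suc c)) (sym (ℕₚ.+-suc c A))))
                  (pairWeight-diag c A (ℕₚ.<⇒≤ A<c))) ⟨
        (S (suc c) + pairWeight n c) + D
      ≡⟨ cong (_+ D) (thresholdSum-step (ℕₚ.≤-trans (ℕₚ.n≤1+n c) (ℕₚ.m≤n+m (suc c) A))) ⟨
        S c + D
      ≡⟨ cong (λ M → S M + D) (ℕₚ.m≤n⇒m⊔n≡n A<c) ⟨
        S (suc A ⊔ c) + D
      ∎
      where
      open ≡-Reasoning
      n : ℕ
      n = A ℕ.+ suc c
      S : ℕ → ℤ
      S = thresholdSum n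
      D : ℤ
      D = (+ A - + c) * e (suc A) * e (suc c)
    ... | tri≈ _ refl _ = begin
        S (A ⊔ suc A)
      ≡⟨ cong S (ℕₚ.m≤n⇒m⊔n≡n (ℕₚ.n≤1+n A)) ⟩
        S (suc A)
      ≡⟨ solve 3 (λ s a f → s := s :+ (a :- a) :* f :* f) refl (S (suc A)) (+ A) (e (suc A)) ⟩
        S (suc A) + (+ A - + A) * e (suc A) * e (suc A)
      ≡⟨ cong (λ M → S M + (+ A - + A) * e (suc A) * e (suc A)) (ℕₚ.m≥n⇒m⊔n≡m (ℕₚ.n≤1+n A)) ⟨
        S (suc A ⊔ A) + (+ A - + A) * e (suc A) * e (suc A)
      ∎
      where
      open ≡-Reasoning
      S : ℕ → ℤ
      S = thresholdSum (A ℕ.+ suc A)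
    ... | tri> _ _ c<A = begin
        S (A ⊔ suc c)
      ≡⟨ cong S (ℕₚ.m≥n⇒m⊔n≡m c<A) ⟩
        S A
      ≡⟨ thresholdSum-step (ℕₚ.m≤m+n A (suc c)) ⟩
        S (suc A) + pairWeight (A ℕ.+ suc c) A
      ≡⟨ cong₂ (λ M t → S M + t) (ℕₚ.m≥n⇒m⊔n≡m (ℕₚ.m≤n⇒m≤1+n (ℕₚ.<⇒≤ c<A)))
                                 (sym (pairWeight-diag A c (ℕₚ.<⇒≤ c<A))) ⟨
        S (suc A ⊔ c) + (+ A - + c) * e (suc A) * e (suc c)
      ∎
      where
      open ≡-Reasoning
      S : ℕ → ℤ
      S = thresholdSum (A ℕ.+ suc c)

    eSum-tail-step : ∀ A c →
      eSum (suc A) (suc c) (suc (A ℕ.+ suc c)) ≡ eSum (suc (suc A)) c (suc (A ℕ.+ suc c)) + (+ A - + c) * e (suc A) * e (suc c)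
    eSum-tail-step A c =
      trans (eSum-tail-expand A (suc c) (A ℕ.+ suc c) ℕₚ.≤-refl)
        (trans (thresholdSum-⊔ A c)
          (cong (_+ (+ A - + c) * e (suc A) * e (suc c))
                (sym (eSum-tail-expand (suc A) c (A ℕ.+ suc c) (ℕₚ.≤-reflexive (ℕₚ.+-suc A c))))))

    eSum-tail : ∀ A c → eSum (suc A) c (suc (A ℕ.+ c)) ≡ reducedChrom A 0 c
    eSum-tail A zero =
      trans (cong (λ n → eSum (suc A) 0 (suc n)) (ℕₚ.+-identityʳ A)) (trans (eSum-tail-zero A) (sym (reducedChrom-tail-zero A)))
    eSum-tail A (suc c) = begin
        eSum (suc A) (suc c) (suc (A ℕ.+ suc c))
      ≡⟨ eSum-tail-step A c ⟩
        eSum (suc (suc A)) c (suc (A ℕ.+ suc c)) + D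
      ≡⟨ cong (λ n → eSum (suc (suc A)) c (suc n) + D) (ℕₚ.+-suc A c) ⟩
        eSum (suc (suc A)) c (suc (suc A ℕ.+ c)) + D
      ≡⟨ cong (_+ D) (eSum-tail (suc A) c) ⟩
        reducedChrom (suc A) 0 c + D
      ≡⟨ reducedChrom-tail-suc A c ⟨
        reducedChrom A 0 (suc c)
      ∎
      where
      open ≡-Reasoning
      D : ℤ
      D = (+ A - + c) * e (suc A) * e (suc c)

    eSum≡reducedChrom : ∀ A b c → eSum (suc A) c (suc A ℕ.+ b ℕ.+ c) ≡ reducedChrom A b c
    eSum≡reducedChrom A zero    c = trans (cong (λ n → eSum (suc A) c (suc (n ℕ.+ c))) (ℕₚ.+-identityʳ A)) (eSum-tail A c)
    eSum≡reducedChrom A (suc b) c = begin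
        eSum (suc A) c (suc (A ℕ.+ suc b ℕ.+ c))
      ≡⟨ cong (λ n → eSum (suc A) c (suc n)) (ℕₚ.+-assoc A (suc b) c) ⟩
        eSum (suc A) c (suc (A ℕ.+ suc (b ℕ.+ c)))
      ≡⟨ eSum-path-step A c (b ℕ.+ c) (s≤s (ℕₚ.m≤n+m c b)) ⟩
        + A * e (suc A) * eSum 1 c (suc (b ℕ.+ c)) + eSum (suc (suc A)) c (suc (A ℕ.+ suc (b ℕ.+ c)))
      ≡⟨ cong₂ (λ s t → + A * e (suc A) * s + t) (eSum≡reducedChrom 0 b c)
           (trans (cong (λ n → eSum (suc (suc A)) c (suc n)) (trans (ℕₚ.+-suc A (b ℕ.+ c)) (cong suc (sym (ℕₚ.+-assoc A b c)))))
             (eSum≡reducedChrom (suc A) b c)) ⟩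
        + A * e (suc A) * reducedChrom 0 b c + reducedChrom (suc A) b c
      ≡⟨ reducedChrom-path-suc A b c ⟨
        reducedChrom A (suc b) c
      ∎
      where open ≡-Reasoning

open import Data.Nat using (ℕ; _+_; _*_; _∸_; _≤_)
open import Data.Nat using (_!)
open import Data.Fin using (Fin)
open import Data.List using (map)
open import Data.Integer using (ℤ; +_) renaming (_+_ to _+ℤ_; _*_ to _*ℤ_)
open import Relation.Binary.PropositionalEquality using (_≡_)
open import Data.Nat using (suc)
open import Data.Integer.Properties using (pos-*)
open import Relation.Binary.PropositionalEquality using (sym; cong₂; module ≡-Reasoning)

theorem3p7 : (a b c : ℕ) → 1 ≤ a → (N : ℕ) → (x : Fin N → ℤ) →
    chromSym (barbell a b c) N x
      ≡ (+ ((a ∸ 1) ! * c !)) *ℤ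
        sumℤ (map (λ I → (+ coef₁ a c I +ℤ + coef₂ a c I) *ℤ eComp N x I)
                  (compositions (a + b + c)))
theorem3p7 (suc A) b c _ N x = begin
    chromSym (barbell (suc A) b c) N x
  ≡⟨ chromSym-barbell N x A b c ⟩
    + (A !) *ℤ + (c !) *ℤ reducedChrom N x A b c
  ≡⟨ cong₂ _*ℤ_ (sym (pos-* (A !) (c !))) (sym (eSum≡reducedChrom N x A b c)) ⟩
    + (A ! * c !) *ℤ eSum N x (suc A) c (suc A + b + c)
  ∎
  where open ≡-Reasoning
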